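{- Let $M$ be a set of $m$ sources and $N$ a set of $n$ sinks, and $\mathbf d: M\to\mathbb Z_{\ge 0}$ with $n = 1+\sum_{\mu}\mathbf d(\mu)$. Let $P_{\mathbf d}$ be the transportation polytope with supply $\mathbf m(\mu) = 1 + m\,\mathbf d(\mu)$ for $\mu\in M$ and demand $\mathbf n(\nu) = m$ for $\nu\in N$. If at least two sources $\mu$ satisfy $\mathbf d(\mu)\ge 1$, then the number of facets of $P_{\mathbf d}$ is exactly $mn$.
   Context: For supply $\mathbf m$ and demand $\mathbf n$ with equal totals, the transportation polytope is $P_{\mathbf m,\mathbf n} = \{x \in \mathbb R_{\ge 0}^{M\times N} : \sum_\nu x_{\mu,\nu} = \mathbf m(\mu)\ \forall \mu,\ \sum_\mu x_{\mu,\nu} = \mathbf n(\nu)\ \forall\nu\}$.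
   Formalization: The transportation polytope $P_{\mathbf d}$ consists of points of ℚ^(M×N) instead of ℝ^(M×N), and the valid inequalities cutting out its faces and facets have rational coefficients. -}

module Defs where

open import Data.Nat as ℕ using (ℕ; zero; suc)
open import Data.Integer using (+_)
open import Data.Fin using (Fin; zero; suc)
open import Data.Rational using (ℚ; 0ℚ; _+_; _*_; _≤_; _/_)
open import Data.Product using (Σ; _×_; ∃; _,_; proj₁; proj₂)
open import Relation.Binary.PropositionalEquality using (_≡_)
open import Relation.Nullary using (¬_)

ℕ→ℚ : ℕ → ℚ
ℕ→ℚ k = (+ k) / 1

Σℕ : ∀ {k} → (Fin k → ℕ) → ℕ
Σℕ {zero}  f = 0
Σℕ {suc k} f = f zero ℕ.+ Σℕ (λ i → f (suc i))

Σℚ : ∀ {k} → (Fin k → ℚ) → ℚ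
Σℚ {zero}  f = 0ℚ
Σℚ {suc k} f = f zero + Σℚ (λ i → f (suc i))

Mat : ℕ → ℕ → Set
Mat m n = Fin m → Fin n → ℚ

SubsetM : ℕ → ℕ → Set₁
SubsetM m n = Mat m n → Set

Transport : ∀ {m n} → (Fin m → ℚ) → (Fin n → ℚ) → SubsetM m n
Transport {m} {n} s t x =
  (∀ μ ν → 0ℚ ≤ x μ ν) ×
  (∀ μ → Σℚ (λ ν → x μ ν) ≡ s μ) ×
  (∀ ν → Σℚ (λ μ → x μ ν) ≡ t ν)

Pd : ∀ {m n} → (Fin m → ℕ) → SubsetM m n
Pd {m} {n} d = Transport (λ μ → ℕ→ℚ (suc (m ℕ.* d μ))) (λ ν → ℕ→ℚ m)

dot : ∀ {m n} → Mat m n → Mat m n → ℚ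
dot c x = Σℚ (λ μ → Σℚ (λ ν → c μ ν * x μ ν))

Valid : ∀ {m n} → SubsetM m n → Mat m n → ℚ → Set
Valid S c δ = ∀ x → S x → dot c x ≤ δ

FaceOf : ∀ {m n} → SubsetM m n → Mat m n → ℚ → SubsetM m n
FaceOf S c δ x = S x × dot c x ≡ δ

AffIndep : ∀ {m n k} → (Fin k → Mat m n) → Set
AffIndep {m} {n} {k} p =
  (λs : Fin k → ℚ) → Σℚ λs ≡ 0ℚ →
  (∀ μ ν → Σℚ (λ i → λs i * p i μ ν) ≡ 0ℚ) →
  ∀ i → λs i ≡ 0ℚ

HasAffIndep : ∀ {m n} → SubsetM m n → ℕ → Set
HasAffIndep {m} {n} S k =
  Σ (Fin (suc k) → Mat m n) λ p → (∀ i → S (p i)) × AffIndep p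

-- dim S = k (for nonempty S): dimension of the affine hull
HasDim : ∀ {m n} → SubsetM m n → ℕ → Set
HasDim S k = HasAffIndep S k × ¬ HasAffIndep S (suc k)

IsFacet : ∀ {m n} → SubsetM m n → Mat m n → ℚ → Set
IsFacet P c δ =
  Valid P c δ × Σ ℕ λ k → HasDim P (suc k) × HasDim (FaceOf P c δ) k

SameSet : ∀ {m n} → SubsetM m n → SubsetM m n → Set
SameSet {m} {n} A B = ∀ (x : Mat m n) → (A x → B x) × (B x → A x)

-- P has exactly k facets (facets counted as subsets of ℚ^{M×N}):
-- a list of k pairwise distinct facets containing every facet
NumFacets : ∀ {m n} → SubsetM m n → ℕ → Set
NumFacets {m} {n} P k =
  Σ (Fin k → Mat m n × ℚ) λ F →
    (∀ i → IsFacet P (proj₁ (F i)) (proj₂ (F i))) ×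
    (∀ i j → SameSet (FaceOf P (proj₁ (F i)) (proj₂ (F i)))
                     (FaceOf P (proj₁ (F j)) (proj₂ (F j))) → i ≡ j) ×
    (∀ c δ → IsFacet P c δ →
       ∃ λ i → SameSet (FaceOf P c δ) (FaceOf P (proj₁ (F i)) (proj₂ (F i))))

-- A transportation polytope P with a point y whose entries are all positive has dimension (m-1)(n-1):
-- moving mass around the rectangles through a fixed row and column gives (m-1)(n-1) independent
-- directions at y, and there are no more since a matrix with zero margins is determined by its
-- block off that row and column. Every facet is a coordinate face x μ ν = 0: otherwise the barycentre
-- of its spanning points is strictly positive, and a valid inequality tight at a strictly positive
-- point of a bounded P is tight on all of P. Conversely x μ ν ≥ 0 defines a facet once the face
-- x μ ν = 0 contains a point r whose other entries are positive; r lies on no other coordinate face,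
-- so the m n coordinate facets are distinct. For P_d such an r moves the mass of the corner (μ, ν)
-- into a row L ≠ μ with d L ≥ 1, which is where the two sources with positive d are needed.
module Submission where

open import Defs
open import Algebra.Bundles using (Ring)
import Algebra.Properties.Group as GroupProperties
import Algebra.Properties.Semiring.Sum as SemiringSum
open import Data.Empty using (⊥-elim)
open import Data.Fin as Fin using (Fin; zero; suc; punchIn; punchOut)
import Data.Fin.Properties as Finₚ
open import Data.Integer as ℤ using ()
import Data.Integer.Solver as ℤ-Solver
open import Data.Nat as ℕ using (ℕ; zero; suc; s≤s; z≤n)
open import Data.Nat.Coprimality using (1-coprimeTo) renaming (sym to coprime-sym)
import Data.Nat.Properties as ℕₚ
import Data.Nat.Solver as ℕ-Solver
open import Data.Product using (Σ; _×_; ∃; ∃₂; _,_; proj₁; proj₂)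
open import Data.Rational as ℚ using (ℚ; 0ℚ; 1ℚ; mkℚ; _+_; _*_; _-_; -_; _≤_; _<_)
import Data.Rational.Properties as ℚₚ
open import Data.Rational.Solver using (module +-*-Solver)
import Data.Rational.Unnormalised as ℚᵘ
import Data.Rational.Unnormalised.Properties as ℚᵘₚ
open import Data.Sum using (inj₁; inj₂)
open import Data.Vec.Functional using (_∷_; insertAt)
import Data.Vec.Functional.Properties as Vecₚ
open import Function using (_∘_)
open import Relation.Binary using (tri<; tri≈; tri>)
open import Relation.Binary.PropositionalEquality
open import Relation.Nullary using (¬_; Dec; yes; no; ¬?)
open import Relation.Nullary.Decidable using (True; toWitness; _×-dec_)

open +-*-Solver
open GroupProperties ℚₚ.+-0-group using (inverseʳ-unique; x∙y⁻¹≈ε⇒x≈y; ⁻¹-involutive)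
module ℕS = ℕ-Solver.+-*-Solver

ℕ→ℚ≡mkℚ : ∀ k → ℕ→ℚ k ≡ mkℚ (ℤ.+ k) 0 (coprime-sym (1-coprimeTo k))
ℕ→ℚ≡mkℚ k = ℚₚ.normalize-coprime (coprime-sym (1-coprimeTo k))

ℕ→ℚ-homo-+ : ∀ a b → ℕ→ℚ (a ℕ.+ b) ≡ ℕ→ℚ a + ℕ→ℚ b
ℕ→ℚ-homo-+ a b = ℚₚ.toℚᵘ-injective
  (ℚᵘₚ.≃-trans unnormalised (ℚᵘₚ.≃-sym (ℚₚ.toℚᵘ-homo-+ (ℕ→ℚ a) (ℕ→ℚ b))))
  where
  module ℤS = ℤ-Solver.+-*-Solver
  unnormalised : ℚ.toℚᵘ (ℕ→ℚ (a ℕ.+ b)) ℚᵘ.≃ ℚ.toℚᵘ (ℕ→ℚ a) ℚᵘ.+ ℚ.toℚᵘ (ℕ→ℚ b)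
  unnormalised rewrite ℕ→ℚ≡mkℚ (a ℕ.+ b) | ℕ→ℚ≡mkℚ a | ℕ→ℚ≡mkℚ b =
    ℚᵘ.*≡* (ℤS.solve 2 (λ x y → (x ℤS.:+ y) ℤS.:* ℤS.con (ℤ.+ 1)
                                 ℤS.:= (x ℤS.:* ℤS.con (ℤ.+ 1) ℤS.:+ y ℤS.:* ℤS.con (ℤ.+ 1)) ℤS.:* ℤS.con (ℤ.+ 1))
                       refl (ℤ.+ a) (ℤ.+ b))

ℕ→ℚ-suc : ∀ a → ℕ→ℚ (suc a) ≡ 1ℚ + ℕ→ℚ a
ℕ→ℚ-suc = ℕ→ℚ-homo-+ 1

ℕ→ℚ-homo-* : ∀ a b → ℕ→ℚ (a ℕ.* b) ≡ ℕ→ℚ a * ℕ→ℚ b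
ℕ→ℚ-homo-* zero    b = sym (ℚₚ.*-zeroˡ (ℕ→ℚ b))
ℕ→ℚ-homo-* (suc a) b = begin
  ℕ→ℚ (b ℕ.+ a ℕ.* b)         ≡⟨ ℕ→ℚ-homo-+ b (a ℕ.* b) ⟩
  ℕ→ℚ b + ℕ→ℚ (a ℕ.* b)       ≡⟨ cong (ℕ→ℚ b +_) (ℕ→ℚ-homo-* a b) ⟩
  ℕ→ℚ b + ℕ→ℚ a * ℕ→ℚ b       ≡⟨ solve 2 (λ x y → y :+ x :* y := (con 1ℚ :+ x) :* y) refl (ℕ→ℚ a) (ℕ→ℚ b) ⟩
  (1ℚ + ℕ→ℚ a) * ℕ→ℚ b        ≡⟨ cong (_* ℕ→ℚ b) (ℕ→ℚ-suc a) ⟨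
  ℕ→ℚ (suc a) * ℕ→ℚ b         ∎
  where open ≡-Reasoning

0≤ℕ→ℚ : ∀ a → 0ℚ ≤ ℕ→ℚ a
0≤ℕ→ℚ a rewrite ℕ→ℚ≡mkℚ a = ℚₚ.nonNegative⁻¹ _

0<ℕ→ℚ[1+n] : ∀ a → 0ℚ < ℕ→ℚ (suc a)
0<ℕ→ℚ[1+n] a rewrite ℕ→ℚ≡mkℚ (suc a) = ℚₚ.positive⁻¹ _

ℕ→ℚ-mono-≤ : ∀ {a b} → a ℕ.≤ b → ℕ→ℚ a ≤ ℕ→ℚ b
ℕ→ℚ-mono-≤ {a} a≤b with c , refl ← ℕₚ.m≤n⇒∃[o]m+o≡n a≤b = begin
  ℕ→ℚ a           ≡⟨ ℚₚ.+-identityʳ (ℕ→ℚ a) ⟨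
  ℕ→ℚ a + 0ℚ      ≤⟨ ℚₚ.+-monoʳ-≤ (ℕ→ℚ a) (0≤ℕ→ℚ c) ⟩
  ℕ→ℚ a + ℕ→ℚ c   ≡⟨ ℕ→ℚ-homo-+ a c ⟨
  ℕ→ℚ (a ℕ.+ c)   ∎
  where open ℚₚ.≤-Reasoning

module ∑ = SemiringSum (Ring.semiring ℚₚ.+-*-ring)

Σℚ≡sum : ∀ {k} (f : Fin k → ℚ) → Σℚ f ≡ ∑.sum f
Σℚ≡sum {zero}  f = refl
Σℚ≡sum {suc k} f = cong (f zero +_) (Σℚ≡sum (f ∘ suc))

Σℚ-cong : ∀ {k} {f g : Fin k → ℚ} → (∀ i → f i ≡ g i) → Σℚ f ≡ Σℚ g
Σℚ-cong {zero}  f≗g = refl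
Σℚ-cong {suc k} f≗g = cong₂ _+_ (f≗g zero) (Σℚ-cong (f≗g ∘ suc))

Σℚ-zero : ∀ {k} (f : Fin k → ℚ) → (∀ i → f i ≡ 0ℚ) → Σℚ f ≡ 0ℚ
Σℚ-zero {zero}  f f≗0 = refl
Σℚ-zero {suc k} f f≗0 = trans (cong₂ _+_ (f≗0 zero) (Σℚ-zero (f ∘ suc) (f≗0 ∘ suc))) (ℚₚ.+-identityˡ 0ℚ)

Σℚ-distrib-+ : ∀ {k} (f g : Fin k → ℚ) → Σℚ (λ i → f i + g i) ≡ Σℚ f + Σℚ g
Σℚ-distrib-+ f g = begin
  Σℚ (λ i → f i + g i)   ≡⟨ Σℚ≡sum (λ i → f i + g i) ⟩
  ∑.sum (λ i → f i + g i) ≡⟨ ∑.∑-distrib-+ f g ⟩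
  ∑.sum f + ∑.sum g       ≡⟨ cong₂ _+_ (Σℚ≡sum f) (Σℚ≡sum g) ⟨
  Σℚ f + Σℚ g             ∎
  where open ≡-Reasoning

Σℚ-comm : ∀ {k l} (f : Fin k → Fin l → ℚ) →
  Σℚ (λ i → Σℚ (λ j → f i j)) ≡ Σℚ (λ j → Σℚ (λ i → f i j))
Σℚ-comm f = begin
  Σℚ (λ i → Σℚ (λ j → f i j))       ≡⟨ trans (Σℚ-cong (λ i → Σℚ≡sum (f i))) (Σℚ≡sum (λ i → ∑.sum (f i))) ⟩
  ∑.sum (λ i → ∑.sum (λ j → f i j)) ≡⟨ ∑.∑-comm f ⟩
  ∑.sum (λ j → ∑.sum (λ i → f i j)) ≡⟨ trans (Σℚ-cong (λ j → Σℚ≡sum (λ i → f i j))) (Σℚ≡sum (λ j → ∑.sum (λ i → f i j))) ⟨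
  Σℚ (λ j → Σℚ (λ i → f i j))       ∎
  where open ≡-Reasoning

Σℚ-factorˡ : ∀ {k} (c : ℚ) (f : Fin k → ℚ) → Σℚ (λ i → c * f i) ≡ c * Σℚ f
Σℚ-factorˡ c f = begin
  Σℚ (λ i → c * f i)    ≡⟨ Σℚ≡sum (λ i → c * f i) ⟩
  ∑.sum (λ i → c * f i) ≡⟨ ∑.*-distribˡ-sum c f ⟨
  c * ∑.sum f           ≡⟨ cong (c *_) (Σℚ≡sum f) ⟨
  c * Σℚ f              ∎
  where open ≡-Reasoning

Σℚ-factorʳ : ∀ {k} (c : ℚ) (f : Fin k → ℚ) → Σℚ (λ i → f i * c) ≡ Σℚ f * c
Σℚ-factorʳ c f = begin
  Σℚ (λ i → f i * c)    ≡⟨ Σℚ≡sum (λ i → f i * c) ⟩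
  ∑.sum (λ i → f i * c) ≡⟨ ∑.*-distribʳ-sum c f ⟨
  ∑.sum f * c           ≡⟨ cong (_* c) (Σℚ≡sum f) ⟨
  Σℚ f * c              ∎
  where open ≡-Reasoning

Σℚ-neg : ∀ {k} (f : Fin k → ℚ) → Σℚ (λ i → - f i) ≡ - Σℚ f
Σℚ-neg {zero}  f = refl
Σℚ-neg {suc k} f = trans (cong (- f zero +_) (Σℚ-neg (f ∘ suc))) (sym (ℚₚ.neg-distrib-+ (f zero) _))

Σℚ-remove : ∀ {k} (i : Fin (suc k)) (f : Fin (suc k) → ℚ) → Σℚ f ≡ f i + Σℚ (f ∘ punchIn i)
Σℚ-remove i f = begin
  Σℚ f                       ≡⟨ Σℚ≡sum f ⟩
  ∑.sum f                    ≡⟨ ∑.sum-remove f ⟩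
  f i + ∑.sum (f ∘ punchIn i) ≡⟨ cong (f i +_) (Σℚ≡sum (f ∘ punchIn i)) ⟨
  f i + Σℚ (f ∘ punchIn i)    ∎
  where open ≡-Reasoning

Σℚ-const : ∀ {k} (c : ℚ) → Σℚ {k} (λ _ → c) ≡ ℕ→ℚ k * c
Σℚ-const {zero}  c = sym (ℚₚ.*-zeroˡ c)
Σℚ-const {suc k} c = begin
  c + Σℚ {k} (λ _ → c)   ≡⟨ cong (c +_) (Σℚ-const {k} c) ⟩
  c + ℕ→ℚ k * c          ≡⟨ solve 2 (λ x y → y :+ x :* y := (con 1ℚ :+ x) :* y) refl (ℕ→ℚ k) c ⟩
  (1ℚ + ℕ→ℚ k) * c       ≡⟨ cong (_* c) (ℕ→ℚ-suc k) ⟨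
  ℕ→ℚ (suc k) * c        ∎
  where open ≡-Reasoning

Σℚ-ℕ→ℚ : ∀ {k} (f : Fin k → ℕ) → Σℚ (ℕ→ℚ ∘ f) ≡ ℕ→ℚ (Σℕ f)
Σℚ-ℕ→ℚ {zero}  f = refl
Σℚ-ℕ→ℚ {suc k} f = trans (cong (ℕ→ℚ (f zero) +_) (Σℚ-ℕ→ℚ (f ∘ suc))) (sym (ℕ→ℚ-homo-+ (f zero) _))

Σℚ-nonneg : ∀ {k} (f : Fin k → ℚ) → (∀ i → 0ℚ ≤ f i) → 0ℚ ≤ Σℚ f
Σℚ-nonneg {zero}  f 0≤f = ℚₚ.≤-refl
Σℚ-nonneg {suc k} f 0≤f = ℚₚ.+-mono-≤ (0≤f zero) (Σℚ-nonneg (f ∘ suc) (0≤f ∘ suc))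

term≤Σℚ : ∀ {k} (f : Fin k → ℚ) → (∀ i → 0ℚ ≤ f i) → ∀ i → f i ≤ Σℚ f
term≤Σℚ {suc k} f 0≤f i = begin
  f i                        ≡⟨ ℚₚ.+-identityʳ (f i) ⟨
  f i + 0ℚ                   ≤⟨ ℚₚ.+-monoʳ-≤ (f i) (Σℚ-nonneg _ (0≤f ∘ punchIn i)) ⟩
  f i + Σℚ (f ∘ punchIn i)   ≡⟨ Σℚ-remove i f ⟨
  Σℚ f                       ∎
  where open ℚₚ.≤-Reasoning

Σℚ-single : ∀ {k} (i : Fin k) (f : Fin k → ℚ) → (∀ j → j ≢ i → f j ≡ 0ℚ) → Σℚ f ≡ f i
Σℚ-single {suc k} i f f≗0 = begin
  Σℚ f                       ≡⟨ Σℚ-remove i f ⟩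
  f i + Σℚ (f ∘ punchIn i)   ≡⟨ cong (f i +_) (Σℚ-zero _ (λ j → f≗0 (punchIn i j) (Finₚ.punchInᵢ≢i i j))) ⟩
  f i + 0ℚ                   ≡⟨ ℚₚ.+-identityʳ (f i) ⟩
  f i                        ∎
  where open ≡-Reasoning

module ∑ℕ = SemiringSum ℕₚ.+-*-semiring
Σℕ≡sum : ∀ {k} (f : Fin k → ℕ) → Σℕ f ≡ ∑ℕ.sum f
Σℕ≡sum {zero}  f = refl
Σℕ≡sum {suc k} f = cong (f zero ℕ.+_) (Σℕ≡sum (f ∘ suc))

Σℕ-factorˡ : ∀ {k} (c : ℕ) (f : Fin k → ℕ) → Σℕ (λ i → c ℕ.* f i) ≡ c ℕ.* Σℕ f
Σℕ-factorˡ c f = trans (Σℕ≡sum (λ i → c ℕ.* f i)) (trans (sym (∑ℕ.*-distribˡ-sum c f)) (cong (c ℕ.*_) (sym (Σℕ≡sum f))))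

Σℕ-suc : ∀ {k} (f : Fin k → ℕ) → Σℕ (λ i → suc (f i)) ≡ k ℕ.+ Σℕ f
Σℕ-suc {zero}  f = refl
Σℕ-suc {suc k} f = cong suc (trans (cong (f zero ℕ.+_) (Σℕ-suc (f ∘ suc)))
                               (ℕS.solve 3 (λ a k b → a ℕS.:+ (k ℕS.:+ b) ℕS.:= k ℕS.:+ (a ℕS.:+ b)) refl (f zero) k (Σℕ (f ∘ suc))))

term≤Σℕ : ∀ {k} (f : Fin k → ℕ) (i : Fin k) → f i ℕ.≤ Σℕ f
term≤Σℕ f zero    = ℕₚ.m≤m+n (f zero) _
term≤Σℕ f (suc i) = ℕₚ.≤-trans (term≤Σℕ (f ∘ suc) i) (ℕₚ.m≤n+m _ (f zero))

two-terms≤Σℕ : ∀ {k} (f : Fin k → ℕ) {a b : Fin k} → a ≢ b → f a ℕ.+ f b ℕ.≤ Σℕ f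
two-terms≤Σℕ {suc k} f {a} {b} a≢b = begin
  f a ℕ.+ f b                        ≡⟨ cong (λ i → f a ℕ.+ f i) (Finₚ.punchIn-punchOut a≢b) ⟨
  f a ℕ.+ f (punchIn a (punchOut a≢b)) ≤⟨ ℕₚ.+-monoʳ-≤ (f a) (term≤Σℕ (f ∘ punchIn a) (punchOut a≢b)) ⟩
  f a ℕ.+ Σℕ (f ∘ punchIn a)         ≡⟨ trans (∑ℕ.sum-remove f) (cong (f a ℕ.+_) (sym (Σℕ≡sum (f ∘ punchIn a)))) ⟨
  ∑ℕ.sum f                           ≡⟨ Σℕ≡sum f ⟨
  Σℕ f                               ∎
  where open ℕₚ.≤-Reasoning

p*q≡0⇒p≡0 : ∀ p q → p * q ≡ 0ℚ → q ≢ 0ℚ → p ≡ 0ℚ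
p*q≡0⇒p≡0 p q pq≡0 q≢0 = begin
  p                ≡⟨ ℚₚ.*-identityʳ p ⟨
  p * 1ℚ           ≡⟨ cong (p *_) (ℚₚ.*-inverseʳ q) ⟨
  p * (q * q⁻¹)    ≡⟨ ℚₚ.*-assoc p q q⁻¹ ⟨
  (p * q) * q⁻¹    ≡⟨ cong (_* q⁻¹) pq≡0 ⟩
  0ℚ * q⁻¹         ≡⟨ ℚₚ.*-zeroˡ q⁻¹ ⟩
  0ℚ               ∎
  where
  open ≡-Reasoning
  instance
    q-nonZero : ℚ.NonZero q
    q-nonZero = ℚ.≢-nonZero q≢0
  q⁻¹ : ℚ
  q⁻¹ = ℚ.1/ q

*-nonneg : ∀ {p q} → 0ℚ ≤ p → 0ℚ ≤ q → 0ℚ ≤ p * q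
*-nonneg {p} {q} 0≤p 0≤q = ℚₚ.nonNegative⁻¹ (p * q) {{ℚₚ.nonNeg*nonNeg⇒nonNeg p {{ℚ.nonNegative 0≤p}} q {{ℚ.nonNegative 0≤q}}}}

*-pos : ∀ {p q} → 0ℚ < p → 0ℚ < q → 0ℚ < p * q
*-pos {p} {q} 0<p 0<q = ℚₚ.positive⁻¹ (p * q) {{ℚₚ.pos*pos⇒pos p {{ℚ.positive 0<p}} q {{ℚ.positive 0<q}}}}

0≤∧≢0⇒0< : ∀ {p} → 0ℚ ≤ p → p ≢ 0ℚ → 0ℚ < p
0≤∧≢0⇒0< {p} 0≤p p≢0 with ℚₚ.<-cmp 0ℚ p
... | tri< 0<p _ _ = 0<p
... | tri≈ _ 0≡p _ = ⊥-elim (p≢0 (sym 0≡p))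
... | tri> _ _ p<0 = ⊥-elim (ℚₚ.<-irrefl refl (ℚₚ.<-≤-trans p<0 0≤p))

p≤q⇒0≤q-p : ∀ {p q} → p ≤ q → 0ℚ ≤ q - p
p≤q⇒0≤q-p {p} {q} p≤q = subst (_≤ q - p) (ℚₚ.+-inverseʳ p) (ℚₚ.+-monoˡ-≤ (- p) p≤q)

opaque
  recip : ∀ {p} → 0ℚ < p → ℚ
  recip {p} 0<p = ℚ.1/_ p {{ℚₚ.pos⇒nonZero p {{ℚ.positive 0<p}}}}

  0<recip : ∀ {p} (0<p : 0ℚ < p) → 0ℚ < recip 0<p
  0<recip {p} 0<p = ℚₚ.positive⁻¹ _ {{ℚₚ.1/pos⇒pos p {{ℚ.positive 0<p}}}}

  *-recip : ∀ {p} (0<p : 0ℚ < p) → p * recip 0<p ≡ 1ℚ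
  *-recip {p} 0<p = ℚₚ.*-inverseʳ p {{ℚₚ.pos⇒nonZero p {{ℚ.positive 0<p}}}}

δ : ∀ {k} → Fin k → Fin k → ℚ
δ i j with i Finₚ.≟ j
... | yes _ = 1ℚ
... | no  _ = 0ℚ

δ-refl : ∀ {k} (i : Fin k) → δ i i ≡ 1ℚ
δ-refl i with i Finₚ.≟ i
... | yes _   = refl
... | no  i≢i = ⊥-elim (i≢i refl)

δ-≢ : ∀ {k} {i j : Fin k} → i ≢ j → δ i j ≡ 0ℚ
δ-≢ {i = i} {j} i≢j with i Finₚ.≟ j
... | yes i≡j = ⊥-elim (i≢j i≡j)
... | no  _   = refl

Σℚ-δ : ∀ {k} (i : Fin k) (f : Fin k → ℚ) → Σℚ (λ j → f j * δ i j) ≡ f i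
Σℚ-δ i f = begin
  Σℚ (λ j → f j * δ i j)  ≡⟨ Σℚ-single i _ (λ j j≢i → trans (cong (f j *_) (δ-≢ (j≢i ∘ sym))) (ℚₚ.*-zeroʳ (f j))) ⟩
  f i * δ i i             ≡⟨ cong (f i *_) (δ-refl i) ⟩
  f i * 1ℚ                ≡⟨ ℚₚ.*-identityʳ (f i) ⟩
  f i                     ∎
  where open ≡-Reasoning

Σℚ-δ-δ : ∀ {k} (a b : Fin k) → Σℚ (λ j → δ a j - δ b j) ≡ 0ℚ
Σℚ-δ-δ a b = begin
  Σℚ (λ j → δ a j - δ b j)     ≡⟨ Σℚ-distrib-+ (δ a) (λ j → - δ b j) ⟩
  Σℚ (δ a) + Σℚ (λ j → - δ b j) ≡⟨ cong (Σℚ (δ a) +_) (Σℚ-neg (δ b)) ⟩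
  Σℚ (δ a) - Σℚ (δ b)           ≡⟨ cong₂ _-_ (Σℚ-δ₁ a) (Σℚ-δ₁ b) ⟩
  1ℚ - 1ℚ                       ≡⟨ ℚₚ.+-inverseʳ 1ℚ ⟩
  0ℚ                            ∎
  where
  open ≡-Reasoning
  Σℚ-δ₁ : ∀ i → Σℚ (δ i) ≡ 1ℚ
  Σℚ-δ₁ i = trans (Σℚ-cong (λ j → sym (ℚₚ.*-identityˡ (δ i j)))) (Σℚ-δ i (λ _ → 1ℚ))

data Sign₃ : ℚ → Set where
  plus   : Sign₃ 1ℚ
  naught : Sign₃ 0ℚ
  minus  : Sign₃ (- 1ℚ)

δ-δ-sign : ∀ {k} (a b j : Fin k) → Sign₃ (δ a j - δ b j)
δ-δ-sign a b j with a Finₚ.≟ j | b Finₚ.≟ j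
... | yes _ | yes _ = naught
... | yes _ | no  _ = plus
... | no  _ | yes _ = minus
... | no  _ | no  _ = naught

by-decision : ∀ {p q} {p≤q : True (p ℚ.≤? q)} → p ≤ q
by-decision {p≤q = p≤q} = toWitness p≤q

-1≤sign*sign : ∀ {u v} → Sign₃ u → Sign₃ v → - 1ℚ ≤ u * v
-1≤sign*sign plus   plus   = by-decision
-1≤sign*sign plus   naught = by-decision
-1≤sign*sign plus   minus  = by-decision
-1≤sign*sign naught plus   = by-decision
-1≤sign*sign naught naught = by-decision
-1≤sign*sign naught minus  = by-decision
-1≤sign*sign minus  plus   = by-decision
-1≤sign*sign minus  naught = by-decision
-1≤sign*sign minus  minus  = by-decision

-- Affine and linear independence

combination : ∀ {m n k} → (Fin k → ℚ) → (Fin k → Mat m n) → Mat m n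
combination λs p μ ν = Σℚ (λ i → λs i * p i μ ν)

dot-cong : ∀ {m n} (c : Mat m n) {x y : Mat m n} → (∀ μ ν → x μ ν ≡ y μ ν) → dot c x ≡ dot c y
dot-cong c x≗y = Σℚ-cong (λ μ → Σℚ-cong (λ ν → cong (c μ ν *_) (x≗y μ ν)))

dot-zero : ∀ {m n} (c x : Mat m n) → (∀ μ ν → x μ ν ≡ 0ℚ) → dot c x ≡ 0ℚ
dot-zero c x x≗0 = trans (dot-cong c x≗0) (Σℚ-zero _ (λ μ → Σℚ-zero _ (λ ν → ℚₚ.*-zeroʳ (c μ ν))))

dot-combination : ∀ {m n k} (c : Mat m n) (λs : Fin k → ℚ) (p : Fin k → Mat m n) →
  Σℚ (λ i → λs i * dot c (p i)) ≡ dot c (combination λs p)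
dot-combination c λs p = begin
  Σℚ (λ i → λs i * Σℚ (λ μ → Σℚ (λ ν → c μ ν * p i μ ν)))
    ≡⟨ Σℚ-cong (λ i → trans (sym (Σℚ-factorˡ (λs i) (λ μ → Σℚ (λ ν → c μ ν * p i μ ν))))
                            (Σℚ-cong (λ μ → sym (Σℚ-factorˡ (λs i) (λ ν → c μ ν * p i μ ν))))) ⟩
  Σℚ (λ i → Σℚ (λ μ → Σℚ (λ ν → term i μ ν)))
    ≡⟨ Σℚ-comm (λ i μ → Σℚ (λ ν → term i μ ν)) ⟩
  Σℚ (λ μ → Σℚ (λ i → Σℚ (λ ν → term i μ ν)))
    ≡⟨ Σℚ-cong (λ μ → Σℚ-comm (λ i ν → term i μ ν)) ⟩
  Σℚ (λ μ → Σℚ (λ ν → Σℚ (λ i → term i μ ν)))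
    ≡⟨ Σℚ-cong (λ μ → Σℚ-cong (λ ν → trans (Σℚ-cong (λ i → swap (λs i) (c μ ν) (p i μ ν)))
                                             (Σℚ-factorˡ (c μ ν) (λ i → λs i * p i μ ν)))) ⟩
  Σℚ (λ μ → Σℚ (λ ν → c μ ν * combination λs p μ ν)) ∎
  where
  open ≡-Reasoning
  term = λ i μ ν → λs i * (c μ ν * p i μ ν)
  swap : ∀ a b x → a * (b * x) ≡ b * (a * x)
  swap = solve 3 (λ a b x → a :* (b :* x) := b :* (a :* x)) refl

dot-affine : ∀ {m n} (c : Mat m n) (a b : ℚ) (x y : Mat m n) →
  dot c (λ μ ν → a * x μ ν + b * y μ ν) ≡ a * dot c x + b * dot c y
dot-affine c a b x y = begin
  Σℚ (λ μ → Σℚ (λ ν → c μ ν * (a * x μ ν + b * y μ ν)))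
    ≡⟨ Σℚ-cong (λ μ → Σℚ-cong (λ ν → distrib (c μ ν) (x μ ν) (y μ ν))) ⟩
  Σℚ (λ μ → Σℚ (λ ν → a * cx μ ν + b * cy μ ν))
    ≡⟨ Σℚ-cong (λ μ → split (cx μ) (cy μ)) ⟩
  Σℚ (λ μ → a * Σℚ (cx μ) + b * Σℚ (cy μ))
    ≡⟨ split (λ μ → Σℚ (cx μ)) (λ μ → Σℚ (cy μ)) ⟩
  a * dot c x + b * dot c y ∎
  where
  open ≡-Reasoning
  cx = λ μ ν → c μ ν * x μ ν
  cy = λ μ ν → c μ ν * y μ ν
  distrib : ∀ c' x' y' → c' * (a * x' + b * y') ≡ a * (c' * x') + b * (c' * y')
  distrib = solve 5 (λ a' b' c' x' y' → c' :* (a' :* x' :+ b' :* y') := a' :* (c' :* x') :+ b' :* (c' :* y')) refl a b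
  split : ∀ {k} (f g : Fin k → ℚ) → Σℚ (λ i → a * f i + b * g i) ≡ a * Σℚ f + b * Σℚ g
  split f g = trans (Σℚ-distrib-+ (λ i → a * f i) (λ i → b * g i)) (cong₂ _+_ (Σℚ-factorˡ a f) (Σℚ-factorˡ b g))

affIndep-∷ : ∀ {m n k} {p : Fin k → Mat m n} → AffIndep p → (c : Mat m n) (b : ℚ) →
  (∀ i → dot c (p i) ≡ b) → (x : Mat m n) → dot c x ≢ b → AffIndep (x ∷ p)
affIndep-∷ {p = p} indep c b on-H x off-H λs Σλ≡0 comb≡0 = all-zero
  where
  open ≡-Reasoning
  λ₀ = λs zero
  λ' = λs ∘ suc
  Σλ'≡-λ₀ : Σℚ λ' ≡ - λ₀
  Σλ'≡-λ₀ = inverseʳ-unique λ₀ (Σℚ λ') Σλ≡0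
  λ₀[cx-b]≡0 : λ₀ * (dot c x - b) ≡ 0ℚ
  λ₀[cx-b]≡0 = begin
    λ₀ * (dot c x - b)                                  ≡⟨ solve 3 (λ l y z → l :* (y :- z) := l :* y :+ (:- l) :* z) refl λ₀ (dot c x) b ⟩
    λ₀ * dot c x + (- λ₀) * b                           ≡⟨ cong (λ l → λ₀ * dot c x + l * b) Σλ'≡-λ₀ ⟨
    λ₀ * dot c x + Σℚ λ' * b                            ≡⟨ cong (λ₀ * dot c x +_) (Σℚ-factorʳ b λ') ⟨
    λ₀ * dot c x + Σℚ (λ i → λ' i * b)                  ≡⟨ cong (λ₀ * dot c x +_) (Σℚ-cong (λ i → cong (λ' i *_) (on-H i))) ⟨
    λ₀ * dot c x + Σℚ (λ i → λ' i * dot c (p i))        ≡⟨ dot-combination c λs (x ∷ p) ⟩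
    dot c (combination λs (x ∷ p))                      ≡⟨ dot-zero c _ comb≡0 ⟩
    0ℚ                                                  ∎
  λ₀≡0 : λ₀ ≡ 0ℚ
  λ₀≡0 = p*q≡0⇒p≡0 λ₀ _ λ₀[cx-b]≡0 (λ cx-b≡0 → off-H (x∙y⁻¹≈ε⇒x≈y (dot c x) b cx-b≡0))
  λ'≡0 : ∀ i → λ' i ≡ 0ℚ
  λ'≡0 = indep λ'
    (trans (sym (ℚₚ.+-identityˡ (Σℚ λ'))) (trans (cong (_+ Σℚ λ') (sym λ₀≡0)) Σλ≡0))
    (λ μ ν → trans (sym (ℚₚ.+-identityˡ _))
               (trans (cong (_+ combination λ' p μ ν) (sym (trans (cong (_* x μ ν) λ₀≡0) (ℚₚ.*-zeroˡ (x μ ν)))))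
                      (comb≡0 μ ν)))
  all-zero : ∀ i → λs i ≡ 0ℚ
  all-zero zero    = λ₀≡0
  all-zero (suc i) = λ'≡0 i

affIndep-star : ∀ {m n k} (x : Mat m n) (Z : Fin k → Mat m n) (pμ : Fin k → Fin m) (pν : Fin k → Fin n)
  {q : ℚ} → q ≢ 0ℚ → (∀ i → Z i (pμ i) (pν i) ≡ q) → (∀ i j → j ≢ i → Z j (pμ i) (pν i) ≡ 0ℚ) →
  AffIndep (x ∷ λ j μ ν → x μ ν + Z j μ ν)
affIndep-star x Z pμ pν {q} q≢0 Z-diag Z-off λs Σλ≡0 comb≡0 = all-zero
  where
  open ≡-Reasoning
  λ₀ = λs zero
  λ' = λs ∘ suc
  combination-Z≡0 : ∀ μ ν → combination λ' Z μ ν ≡ 0ℚ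
  combination-Z≡0 μ ν = begin
    ΣλZ                                            ≡⟨ ℚₚ.+-identityˡ ΣλZ ⟨
    0ℚ + ΣλZ                                       ≡⟨ cong (_+ ΣλZ) (trans (cong (_* x μ ν) Σλ≡0) (ℚₚ.*-zeroˡ (x μ ν))) ⟨
    (λ₀ + Σℚ λ') * x μ ν + ΣλZ                     ≡⟨ solve 4 (λ a b c d → (a :+ b) :* c :+ d := a :* c :+ (b :* c :+ d)) refl λ₀ (Σℚ λ') (x μ ν) ΣλZ ⟩
    λ₀ * x μ ν + (Σℚ λ' * x μ ν + ΣλZ)             ≡⟨ cong (λ s → λ₀ * x μ ν + (s + ΣλZ)) (Σℚ-factorʳ (x μ ν) λ') ⟨
    λ₀ * x μ ν + (Σℚ (λ j → λ' j * x μ ν) + ΣλZ)   ≡⟨ cong (λ₀ * x μ ν +_) (Σℚ-distrib-+ (λ j → λ' j * x μ ν) (λ j → λ' j * Z j μ ν)) ⟨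
    λ₀ * x μ ν + Σℚ (λ j → λ' j * x μ ν + λ' j * Z j μ ν)
      ≡⟨ cong (λ₀ * x μ ν +_) (Σℚ-cong (λ j → ℚₚ.*-distribˡ-+ (λ' j) (x μ ν) (Z j μ ν))) ⟨
    λ₀ * x μ ν + Σℚ (λ j → λ' j * (x μ ν + Z j μ ν)) ≡⟨ comb≡0 μ ν ⟩
    0ℚ                                             ∎
    where ΣλZ = combination λ' Z μ ν
  λ'≡0 : ∀ i → λ' i ≡ 0ℚ
  λ'≡0 i = p*q≡0⇒p≡0 (λ' i) q λ'q≡0 q≢0
    where
    λ'q≡0 : λ' i * q ≡ 0ℚ
    λ'q≡0 = begin
      λ' i * q                           ≡⟨ cong (λ' i *_) (Z-diag i) ⟨
      λ' i * Z i (pμ i) (pν i)           ≡⟨ Σℚ-single i _ (λ j j≢i → trans (cong (λ' j *_) (Z-off i j j≢i)) (ℚₚ.*-zeroʳ (λ' j))) ⟨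
      combination λ' Z (pμ i) (pν i)     ≡⟨ combination-Z≡0 (pμ i) (pν i) ⟩
      0ℚ                                 ∎
  all-zero : ∀ i → λs i ≡ 0ℚ
  all-zero zero    = trans (sym (ℚₚ.+-identityʳ λ₀)) (trans (cong (λ₀ +_) (sym (Σℚ-zero λ' λ'≡0))) Σλ≡0)
  all-zero (suc i) = λ'≡0 i

LinearlyDependent : ∀ {k K} → (Fin k → Fin K → ℚ) → Set
LinearlyDependent {k} v = ∃ λ (λs : Fin k → ℚ) → (∃ λ i → λs i ≢ 0ℚ) × (∀ c → Σℚ (λ i → λs i * v i c) ≡ 0ℚ)

private
  dependent-zeroColumn : ∀ {k K} (v : Fin (suc k) → Fin (suc K) → ℚ) → (∀ i → v i zero ≡ 0ℚ) →
    LinearlyDependent (λ i c → v (suc i) (suc c)) → LinearlyDependent v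
  dependent-zeroColumn v v·0≡0 (λs , (i , λsᵢ≢0) , λs·v≡0) = 0ℚ ∷ λs , (suc i , λsᵢ≢0) , combination≡0
    where
    combination≡0 : ∀ c → Σℚ (λ i → (0ℚ ∷ λs) i * v i c) ≡ 0ℚ
    combination≡0 zero    = trans (cong₂ _+_ (ℚₚ.*-zeroˡ (v zero zero))
                                    (Σℚ-zero _ (λ i → trans (cong (λs i *_) (v·0≡0 (suc i))) (ℚₚ.*-zeroʳ (λs i)))))
                                  (ℚₚ.+-identityˡ 0ℚ)
    combination≡0 (suc c) = trans (cong₂ _+_ (ℚₚ.*-zeroˡ (v zero (suc c))) (λs·v≡0 c)) (ℚₚ.+-identityˡ 0ℚ)

  -- Gaussian elimination of the first coordinate against the pivot vector p.
  eliminate : ∀ {k K} → (Fin (suc k) → Fin (suc K) → ℚ) → Fin (suc k) → Fin k → Fin K → ℚ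
  eliminate v p i c = v p zero * v (punchIn p i) (suc c) - v (punchIn p i) zero * v p (suc c)

  dependent-pivot : ∀ {k K} (v : Fin (suc k) → Fin (suc K) → ℚ) (p : Fin (suc k)) → v p zero ≢ 0ℚ →
    LinearlyDependent (eliminate v p) → LinearlyDependent v
  dependent-pivot v p a≢0 (β , (i , βᵢ≢0) , β·w≡0) = λs , (punchIn p i , λsᵢ≢0) , combination≡0
    where
    open ≡-Reasoning
    a = v p zero
    v' = v ∘ punchIn p
    A = - Σℚ (λ i → β i * v' i zero)
    λs = insertAt (λ i → a * β i) p A
    λsᵢ≢0 : λs (punchIn p i) ≢ 0ℚ
    λsᵢ≢0 λsᵢ≡0 = βᵢ≢0 (p*q≡0⇒p≡0 (β i) a (trans (ℚₚ.*-comm (β i) a)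
                      (trans (sym (Vecₚ.insertAt-punchIn (λ i → a * β i) p A i)) λsᵢ≡0)) a≢0)
    reduced : ∀ c → Σℚ (λ i → λs i * v i c) ≡ Σℚ (λ i → β i * (a * v' i c - v' i zero * v p c))
    reduced c = begin
      Σℚ (λ i → λs i * v i c)
        ≡⟨ Σℚ-remove p (λ i → λs i * v i c) ⟩
      λs p * v p c + Σℚ (λ i → λs (punchIn p i) * v' i c)
        ≡⟨ cong₂ _+_ (cong (_* v p c) (Vecₚ.insertAt-lookup _ p A))
                     (Σℚ-cong (λ i → cong (_* v' i c) (Vecₚ.insertAt-punchIn _ p A i))) ⟩
      A * v p c + Σℚ (λ i → a * β i * v' i c)
        ≡⟨ cong (_+ Σℚ (λ i → a * β i * v' i c))
             (trans (sym (ℚₚ.neg-distribˡ-* (Σℚ (λ i → β i * v' i zero)) (v p c)))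
                    (trans (cong -_ (sym (Σℚ-factorʳ (v p c) (λ i → β i * v' i zero))))
                           (sym (Σℚ-neg (λ i → β i * v' i zero * v p c))))) ⟩
      Σℚ (λ i → - (β i * v' i zero * v p c)) + Σℚ (λ i → a * β i * v' i c)
        ≡⟨ Σℚ-distrib-+ (λ i → - (β i * v' i zero * v p c)) (λ i → a * β i * v' i c) ⟨
      Σℚ (λ i → - (β i * v' i zero * v p c) + a * β i * v' i c)
        ≡⟨ Σℚ-cong (λ i → solve 5 (λ b x y z q → :- (b :* x :* y) :+ q :* b :* z := b :* (q :* z :- x :* y))
                              refl (β i) (v' i zero) (v p c) (v' i c) a) ⟩
      Σℚ (λ i → β i * (a * v' i c - v' i zero * v p c)) ∎
    combination≡0 : ∀ c → Σℚ (λ i → λs i * v i c) ≡ 0ℚ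
    combination≡0 zero    = trans (reduced zero)
      (Σℚ-zero _ (λ i → solve 3 (λ b x q → b :* (q :* x :- x :* q) := con 0ℚ) refl (β i) (v' i zero) a))
    combination≡0 (suc c) = trans (reduced (suc c)) (β·w≡0 c)

linearDependence : ∀ K (v : Fin (suc K) → Fin K → ℚ) → LinearlyDependent v
linearDependence zero    v = (λ _ → 1ℚ) , (zero , λ ()) , λ ()
linearDependence (suc K) v with Finₚ.any? (λ i → ¬? (v i zero ℚₚ.≟ 0ℚ))
... | yes (p , a≢0) = dependent-pivot v p a≢0 (linearDependence K (eliminate v p))
... | no  no-pivot  = dependent-zeroColumn v column₀≡0 (linearDependence K (λ i c → v (suc i) (suc c)))
  where
  column₀≡0 : ∀ i → v i zero ≡ 0ℚ
  column₀≡0 i with v i zero ℚₚ.≟ 0ℚ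
  ... | yes vᵢ≡0 = vᵢ≡0
  ... | no  vᵢ≢0 = ⊥-elim (no-pivot (i , vᵢ≢0))

-- Transportation polytopes

ZeroMargins : ∀ {m n} → Mat m n → Set
ZeroMargins Z = (∀ μ → Σℚ (Z μ) ≡ 0ℚ) × (∀ ν → Σℚ (λ μ → Z μ ν) ≡ 0ℚ)

zeroMargins-scale : ∀ {m n} (ε : ℚ) {Z : Mat m n} → ZeroMargins Z → ZeroMargins (λ μ ν → ε * Z μ ν)
zeroMargins-scale ε {Z} (rows , cols) =
  (λ μ → trans (Σℚ-factorˡ ε (Z μ)) (trans (cong (ε *_) (rows μ)) (ℚₚ.*-zeroʳ ε))) ,
  (λ ν → trans (Σℚ-factorˡ ε (λ μ → Z μ ν)) (trans (cong (ε *_) (cols ν)) (ℚₚ.*-zeroʳ ε)))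

zeroMargins-outer : ∀ {m n} (u : Fin m → ℚ) (v : Fin n → ℚ) → Σℚ u ≡ 0ℚ → Σℚ v ≡ 0ℚ →
  ZeroMargins (λ μ ν → u μ * v ν)
zeroMargins-outer u v Σu≡0 Σv≡0 =
  (λ μ → trans (Σℚ-factorˡ (u μ) v) (trans (cong (u μ *_) Σv≡0) (ℚₚ.*-zeroʳ (u μ)))) ,
  (λ ν → trans (Σℚ-factorʳ (v ν) u) (trans (cong (_* v ν) Σu≡0) (ℚₚ.*-zeroˡ (v ν))))

Σℚ-combination : ∀ {k l} (λs : Fin k → ℚ) (f : Fin k → Fin l → ℚ) (a : ℚ) → (∀ i → Σℚ (f i) ≡ a) →
  Σℚ (λ j → Σℚ (λ i → λs i * f i j)) ≡ Σℚ λs * a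
Σℚ-combination λs f a Σf≡a = begin
  Σℚ (λ j → Σℚ (λ i → λs i * f i j)) ≡⟨ Σℚ-comm (λ j i → λs i * f i j) ⟩
  Σℚ (λ i → Σℚ (λ j → λs i * f i j)) ≡⟨ Σℚ-cong (λ i → trans (Σℚ-factorˡ (λs i) (f i)) (cong (λs i *_) (Σf≡a i))) ⟩
  Σℚ (λ i → λs i * a)                ≡⟨ Σℚ-factorʳ a λs ⟩
  Σℚ λs * a                          ∎
  where open ≡-Reasoning

module _ {m n : ℕ} (s : Fin m → ℚ) (t : Fin n → ℚ) where

  private
    P : SubsetM m n
    P = Transport s t

  transport-shift : ∀ {x Z} → P x → ZeroMargins Z → (∀ μ ν → 0ℚ ≤ x μ ν + Z μ ν) → P (λ μ ν → x μ ν + Z μ ν)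
  transport-shift {x} {Z} (_ , rows , cols) (Z-rows , Z-cols) 0≤x+Z = 0≤x+Z ,
    (λ μ → trans (Σℚ-distrib-+ (x μ) (Z μ)) (trans (cong₂ _+_ (rows μ) (Z-rows μ)) (ℚₚ.+-identityʳ (s μ)))) ,
    (λ ν → trans (Σℚ-distrib-+ (λ μ → x μ ν) (λ μ → Z μ ν)) (trans (cong₂ _+_ (cols ν) (Z-cols ν)) (ℚₚ.+-identityʳ (t ν))))

  zeroMargins-difference : ∀ {x y} → P x → P y → ZeroMargins (λ μ ν → y μ ν - x μ ν)
  zeroMargins-difference {x} {y} (_ , x-rows , x-cols) (_ , y-rows , y-cols) =
    (λ μ → cancel (y μ) (x μ) (y-rows μ) (x-rows μ)) ,
    (λ ν → cancel (λ μ → y μ ν) (λ μ → x μ ν) (y-cols ν) (x-cols ν))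
    where
    cancel : ∀ {k} (f g : Fin k → ℚ) {a} → Σℚ f ≡ a → Σℚ g ≡ a → Σℚ (λ i → f i - g i) ≡ 0ℚ
    cancel f g {a} Σf≡a Σg≡a = begin
      Σℚ (λ i → f i - g i)          ≡⟨ Σℚ-distrib-+ f (λ i → - g i) ⟩
      Σℚ f + Σℚ (λ i → - g i)       ≡⟨ cong₂ _+_ Σf≡a (trans (Σℚ-neg g) (cong -_ Σg≡a)) ⟩
      a - a                         ≡⟨ ℚₚ.+-inverseʳ a ⟩
      0ℚ                            ∎
      where open ≡-Reasoning

  zeroMargins-combination : ∀ {k} (λs : Fin k → ℚ) (p : Fin k → Mat m n) → (∀ i → P (p i)) →
    Σℚ λs ≡ 0ℚ → ZeroMargins (combination λs p)
  zeroMargins-combination λs p p∈P Σλ≡0 =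
    (λ μ → trans (Σℚ-combination λs (λ i → p i μ) (s μ) (λ i → proj₁ (proj₂ (p∈P i)) μ)) (annihilate (s μ))) ,
    (λ ν → trans (Σℚ-combination λs (λ i μ → p i μ ν) (t ν) (λ i → proj₂ (proj₂ (p∈P i)) ν)) (annihilate (t ν)))
    where
    annihilate : ∀ a → Σℚ λs * a ≡ 0ℚ
    annihilate a = trans (cong (_* a) Σλ≡0) (ℚₚ.*-zeroˡ a)

  transport-convex : ∀ {k} (w : Fin k → ℚ) (p : Fin k → Mat m n) → (∀ i → 0ℚ ≤ w i) → Σℚ w ≡ 1ℚ →
    (∀ i → P (p i)) → P (combination w p)
  transport-convex w p 0≤w Σw≡1 p∈P =
    (λ μ ν → Σℚ-nonneg (λ i → w i * p i μ ν) (λ i → *-nonneg (0≤w i) (proj₁ (p∈P i) μ ν))) ,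
    (λ μ → trans (Σℚ-combination w (λ i → p i μ) (s μ) (λ i → proj₁ (proj₂ (p∈P i)) μ)) (normalised (s μ))) ,
    (λ ν → trans (Σℚ-combination w (λ i μ → p i μ ν) (t ν) (λ i → proj₂ (proj₂ (p∈P i)) ν)) (normalised (t ν)))
    where
    normalised : ∀ a → Σℚ w * a ≡ a
    normalised a = trans (cong (_* a) Σw≡1) (ℚₚ.*-identityˡ a)

  transport-≤-demand : ∀ {x} → P x → ∀ μ ν → x μ ν ≤ t ν
  transport-≤-demand {x} (0≤x , _ , cols) μ ν = subst (x μ ν ≤_) (cols ν) (term≤Σℚ (λ μ' → x μ' ν) (λ μ' → 0≤x μ' ν) μ)

  transport-step : ∀ {x z ε} → P x → P z → 0ℚ ≤ ε → (∀ μ ν → ε * x μ ν ≤ z μ ν) →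
    P (λ μ ν → z μ ν + ε * (z μ ν - x μ ν))
  transport-step {x} {z} {ε} x∈P z∈P 0≤ε εx≤z =
    transport-shift z∈P (zeroMargins-scale ε (zeroMargins-difference x∈P z∈P)) 0≤step
    where
    0≤step : ∀ μ ν → 0ℚ ≤ z μ ν + ε * (z μ ν - x μ ν)
    0≤step μ ν = begin
      0ℚ                                  ≤⟨ ℚₚ.+-mono-≤ (p≤q⇒0≤q-p (εx≤z μ ν)) (*-nonneg 0≤ε (proj₁ z∈P μ ν)) ⟩
      (z μ ν - ε * x μ ν) + ε * z μ ν     ≡⟨ solve 3 (λ a e y → (a :- e :* y) :+ e :* a := a :+ e :* (a :- y)) refl (z μ ν) ε (x μ ν) ⟩
      z μ ν + ε * (z μ ν - x μ ν)         ∎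
      where open ℚₚ.≤-Reasoning

-- Coordinate faces and facets

negUnit : ∀ {m n} → Fin m → Fin n → Mat m n
negUnit μ₀ ν₀ μ ν = - (δ μ₀ μ * δ ν₀ ν)

CoordinateFace : ∀ {m n} → SubsetM m n → Fin m → Fin n → SubsetM m n
CoordinateFace P μ ν = FaceOf P (negUnit μ ν) 0ℚ

dot-negUnit : ∀ {m n} (μ₀ : Fin m) (ν₀ : Fin n) (x : Mat m n) → dot (negUnit μ₀ ν₀) x ≡ - x μ₀ ν₀
dot-negUnit μ₀ ν₀ x = begin
  Σℚ (λ μ → Σℚ (λ ν → - (δ μ₀ μ * δ ν₀ ν) * x μ ν))
    ≡⟨ Σℚ-cong (λ μ → Σℚ-cong (λ ν → solve 3 (λ a b y → (:- (a :* b)) :* y := (:- (y :* a)) :* b) refl (δ μ₀ μ) (δ ν₀ ν) (x μ ν))) ⟩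
  Σℚ (λ μ → Σℚ (λ ν → - (x μ ν * δ μ₀ μ) * δ ν₀ ν))
    ≡⟨ Σℚ-cong (λ μ → Σℚ-δ ν₀ (λ ν → - (x μ ν * δ μ₀ μ))) ⟩
  Σℚ (λ μ → - (x μ ν₀ * δ μ₀ μ))
    ≡⟨ Σℚ-neg (λ μ → x μ ν₀ * δ μ₀ μ) ⟩
  - Σℚ (λ μ → x μ ν₀ * δ μ₀ μ)
    ≡⟨ cong -_ (Σℚ-δ μ₀ (λ μ → x μ ν₀)) ⟩
  - x μ₀ ν₀ ∎
  where open ≡-Reasoning

dot-negUnit≡0 : ∀ {m n} (μ : Fin m) (ν : Fin n) (x : Mat m n) → x μ ν ≡ 0ℚ → dot (negUnit μ ν) x ≡ 0ℚ
dot-negUnit≡0 μ ν x x≡0 = trans (dot-negUnit μ ν x) (cong -_ x≡0)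

dot-negUnit≡0⇒≡0 : ∀ {m n} (μ : Fin m) (ν : Fin n) (x : Mat m n) → dot (negUnit μ ν) x ≡ 0ℚ → x μ ν ≡ 0ℚ
dot-negUnit≡0⇒≡0 μ ν x -x≡0 = trans (sym (⁻¹-involutive (x μ ν))) (cong -_ (trans (sym (dot-negUnit μ ν x)) -x≡0))

negUnit-valid : ∀ {m n} (s : Fin m → ℚ) (t : Fin n → ℚ) μ ν → Valid (Transport s t) (negUnit μ ν) 0ℚ
negUnit-valid s t μ ν x (0≤x , _) = subst (_≤ 0ℚ) (sym (dot-negUnit μ ν x)) (ℚₚ.neg-antimono-≤ (0≤x μ ν))

-- Adding a point of P off the hyperplane to independent points of G raises their number.
¬affIndep-section : ∀ {m n} {P G : SubsetM m n} {K} → (∀ x → G x → P x) → (c : Mat m n) (b : ℚ) →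
  (∀ x → G x → dot c x ≡ b) → ∀ {y} → P y → dot c y ≢ b → ¬ HasAffIndep P (suc K) → ¬ HasAffIndep G K
¬affIndep-section G⊆P c b G⊆H {y} y∈P y∉H ¬indepP (p , p∈G , indep) =
  ¬indepP (y ∷ p , (λ { zero → y∈P ; (suc i) → G⊆P (p i) (p∈G i) }) ,
           affIndep-∷ indep c b (λ i → G⊆H (p i) (p∈G i)) y y∉H)

positive-lowerBound : ∀ {k} (f : Fin k → ℚ) → (∀ i → 0ℚ < f i) → ∃ λ η → 0ℚ < η × (∀ i → η ≤ f i)
positive-lowerBound {zero}  f 0<f = 1ℚ , ℚₚ.positive⁻¹ 1ℚ , λ ()
positive-lowerBound {suc k} f 0<f with positive-lowerBound (f ∘ suc) (0<f ∘ suc)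
... | η , 0<η , η≤f with ℚₚ.≤-total (f zero) η
...   | inj₁ f₀≤η = f zero , 0<f zero , λ { zero → ℚₚ.≤-refl ; (suc i) → ℚₚ.≤-trans f₀≤η (η≤f i) }
...   | inj₂ η≤f₀ = η , 0<η , λ { zero → η≤f₀ ; (suc i) → η≤f i }

positive-lowerBound₂ : ∀ {m n} (x : Mat m n) → (∀ μ ν → 0ℚ < x μ ν) → ∃ λ η → 0ℚ < η × (∀ μ ν → η ≤ x μ ν)
positive-lowerBound₂ x 0<x = η , 0<η , λ μ ν → ℚₚ.≤-trans (η≤rows μ) (proj₂ (proj₂ (row-bound μ)) ν)
  where
  row-bound = λ μ → positive-lowerBound (x μ) (0<x μ)
  bound = positive-lowerBound (λ μ → proj₁ (row-bound μ)) (λ μ → proj₁ (proj₂ (row-bound μ)))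
  η = proj₁ bound
  0<η = proj₁ (proj₂ bound)
  η≤rows = proj₂ (proj₂ bound)

barycentre : ∀ {m n k} → (Fin (suc k) → Mat m n) → Mat m n
barycentre {k = k} = combination (λ _ → recip (0<ℕ→ℚ[1+n] k))

private
  barycentre-weights : ∀ k → Σℚ {suc k} (λ _ → recip (0<ℕ→ℚ[1+n] k)) ≡ 1ℚ
  barycentre-weights k = trans (Σℚ-const {suc k} _) (*-recip (0<ℕ→ℚ[1+n] k))

barycentre-∈ : ∀ {m n k} (s : Fin m → ℚ) (t : Fin n → ℚ) (p : Fin (suc k) → Mat m n) →
  (∀ i → Transport s t (p i)) → Transport s t (barycentre p)
barycentre-∈ {k = k} s t p p∈P = transport-convex s t _ p
  (λ _ → ℚₚ.<⇒≤ (0<recip (0<ℕ→ℚ[1+n] k))) (barycentre-weights k) p∈P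

dot-barycentre : ∀ {m n k} (c : Mat m n) {b} (p : Fin (suc k) → Mat m n) → (∀ i → dot c (p i) ≡ b) →
  dot c (barycentre p) ≡ b
dot-barycentre {k = k} c {b} p cp≡b = begin
  dot c (barycentre p)             ≡⟨ dot-combination c (λ _ → w) p ⟨
  Σℚ (λ i → w * dot c (p i))       ≡⟨ Σℚ-cong (λ i → cong (w *_) (cp≡b i)) ⟩
  Σℚ {suc k} (λ _ → w * b)         ≡⟨ Σℚ-factorʳ {suc k} b (λ _ → w) ⟩
  Σℚ {suc k} (λ _ → w) * b         ≡⟨ cong (_* b) (barycentre-weights k) ⟩
  1ℚ * b                           ≡⟨ ℚₚ.*-identityˡ b ⟩
  b                                ∎
  where
  open ≡-Reasoning
  w = recip (0<ℕ→ℚ[1+n] k)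

barycentre-positive : ∀ {m n k} (p : Fin (suc k) → Mat m n) → (∀ i μ ν → 0ℚ ≤ p i μ ν) →
  (∀ μ ν → ∃ λ i → p i μ ν ≢ 0ℚ) → ∀ μ ν → 0ℚ < barycentre p μ ν
barycentre-positive {k = k} p 0≤p nonzero μ ν = ℚₚ.<-≤-trans
  (*-pos 0<w (0≤∧≢0⇒0< (0≤p i μ ν) (proj₂ (nonzero μ ν))))
  (term≤Σℚ (λ j → w * p j μ ν) (λ j → *-nonneg (ℚₚ.<⇒≤ 0<w) (0≤p j μ ν)) i)
  where
  w = recip (0<ℕ→ℚ[1+n] k)
  0<w = 0<recip (0<ℕ→ℚ[1+n] k)
  i = proj₁ (nonzero μ ν)

module _ {m n : ℕ} (s : Fin m → ℚ) (t : Fin n → ℚ) {B : ℚ} (0<B : 0ℚ < B) (t≤B : ∀ ν → t ν ≤ B) where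

  private
    P : SubsetM m n
    P = Transport s t

  uniform-step : ∀ {z} → (∀ μ ν → 0ℚ < z μ ν) → ∃ λ ε → 0ℚ < ε × (∀ {x} → P x → ∀ μ ν → ε * x μ ν ≤ z μ ν)
  uniform-step {z} 0<z = ε , 0<ε , εx≤z
    where
    η = proj₁ (positive-lowerBound₂ z 0<z)
    0<η = proj₁ (proj₂ (positive-lowerBound₂ z 0<z))
    η≤z = proj₂ (proj₂ (positive-lowerBound₂ z 0<z))
    ε : ℚ
    ε = η * recip 0<B
    0<ε : 0ℚ < ε
    0<ε = *-pos 0<η (0<recip 0<B)
    εB≡η : ε * B ≡ η
    εB≡η = trans (solve 3 (λ e b i → e :* i :* b := e :* (b :* i)) refl η B (recip 0<B))
                 (trans (cong (η *_) (*-recip 0<B)) (ℚₚ.*-identityʳ η))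
    εx≤z : ∀ {x} → P x → ∀ μ ν → ε * x μ ν ≤ z μ ν
    εx≤z {x} x∈P μ ν = begin
      ε * x μ ν ≤⟨ ℚₚ.*-monoˡ-≤-nonNeg ε {{ℚ.nonNegative (ℚₚ.<⇒≤ 0<ε)}} (ℚₚ.≤-trans (transport-≤-demand s t x∈P μ ν) (t≤B ν)) ⟩
      ε * B     ≡⟨ εB≡η ⟩
      η         ≤⟨ η≤z μ ν ⟩
      z μ ν     ∎
      where open ℚₚ.≤-Reasoning

  -- z can be pushed a little beyond itself away from any x inside P, so a valid inequality
  -- tight at z cannot be slack at x.
  tight-at-positive⇒tight : ∀ {c b z} → Valid P c b → P z → dot c z ≡ b → (∀ μ ν → 0ℚ < z μ ν) →
    ∀ x → P x → dot c x ≡ b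
  tight-at-positive⇒tight {c} {b} {z} valid z∈P cz≡b 0<z x x∈P = ℚₚ.≤-antisym (valid x x∈P) b≤cx
    where
    ε = proj₁ (uniform-step 0<z)
    0<ε = proj₁ (proj₂ (uniform-step 0<z))
    w∈P : P (λ μ ν → z μ ν + ε * (z μ ν - x μ ν))
    w∈P = transport-step s t x∈P z∈P (ℚₚ.<⇒≤ 0<ε) (proj₂ (proj₂ (uniform-step 0<z)) x∈P)
    cw≡ : dot c (λ μ ν → z μ ν + ε * (z μ ν - x μ ν)) ≡ (1ℚ + ε) * b + (- ε) * dot c x
    cw≡ = begin
      dot c (λ μ ν → z μ ν + ε * (z μ ν - x μ ν))
        ≡⟨ dot-cong c (λ μ ν → solve 3 (λ a e y → a :+ e :* (a :- y) := (con 1ℚ :+ e) :* a :+ (:- e) :* y) refl (z μ ν) ε (x μ ν)) ⟩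
      dot c (λ μ ν → (1ℚ + ε) * z μ ν + (- ε) * x μ ν) ≡⟨ dot-affine c (1ℚ + ε) (- ε) z x ⟩
      (1ℚ + ε) * dot c z + (- ε) * dot c x              ≡⟨ cong (λ a → (1ℚ + ε) * a + (- ε) * dot c x) cz≡b ⟩
      (1ℚ + ε) * b + (- ε) * dot c x                    ∎
      where open ≡-Reasoning
    εb≤εcx : ε * b ≤ ε * dot c x
    εb≤εcx = begin
      ε * b                                                  ≡⟨ solve 3 (λ e a y → e :* a := ((con 1ℚ :+ e) :* a :+ (:- e) :* y) :+ (e :* y :- a)) refl ε b (dot c x) ⟩
      ((1ℚ + ε) * b + (- ε) * dot c x) + (ε * dot c x - b)   ≤⟨ ℚₚ.+-monoˡ-≤ (ε * dot c x - b) (subst (_≤ b) cw≡ (valid _ w∈P)) ⟩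
      b + (ε * dot c x - b)                                  ≡⟨ solve 3 (λ e a y → a :+ (e :* y :- a) := e :* y) refl ε b (dot c x) ⟩
      ε * dot c x                                            ∎
      where open ℚₚ.≤-Reasoning
    b≤cx : b ≤ dot c x
    b≤cx = ℚₚ.*-cancelˡ-≤-pos ε {{ℚ.positive 0<ε}} εb≤εcx

  module _ {c b} (valid : Valid P c b) {k} (dimP : HasDim P (suc k)) (dimF : HasDim (FaceOf P c b) k) where

    private
      F : SubsetM m n
      F = FaceOf P c b
      p : Fin (suc k) → Mat m n
      p = proj₁ (proj₁ dimF)
      p∈F : ∀ j → F (p j)
      p∈F = proj₁ (proj₂ (proj₁ dimF))
      p-indep : AffIndep p
      p-indep = proj₂ (proj₂ (proj₁ dimF))

    facet-vanishes-somewhere : ¬ (∀ μ ν → ∃ λ j → p j μ ν ≢ 0ℚ)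
    facet-vanishes-somewhere nowhere-vanishing = proj₂ dimF (P-points , P-points∈F , P-indep)
      where
      P-points = proj₁ (proj₁ dimP)
      P-indep = proj₂ (proj₂ (proj₁ dimP))
      centre-positive : ∀ μ ν → 0ℚ < barycentre p μ ν
      centre-positive = barycentre-positive p (λ j → proj₁ (proj₁ (p∈F j))) nowhere-vanishing
      centre∈P : P (barycentre p)
      centre∈P = barycentre-∈ s t p (λ j → proj₁ (p∈F j))
      P-points∈F : ∀ i → F (P-points i)
      P-points∈F i = P-point∈P , tight-at-positive⇒tight {c} {b} valid centre∈P (dot-barycentre c p (λ j → proj₂ (p∈F j))) centre-positive _ P-point∈P
        where P-point∈P = proj₁ (proj₂ (proj₁ dimP)) i

    facet-vanishing⇒coordinateFace : ∀ {y} → P y → ∀ μ ν → y μ ν ≢ 0ℚ → (∀ j → p j μ ν ≡ 0ℚ) →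
      SameSet F (CoordinateFace P μ ν)
    facet-vanishing⇒coordinateFace {y} y∈P μ ν y≢0 p≡0 x = F⊆G , G⊆F
      where
      p∈G : ∀ j → dot (negUnit μ ν) (p j) ≡ 0ℚ
      p∈G j = dot-negUnit≡0 μ ν (p j) (p≡0 j)
      F⊆G : F x → CoordinateFace P μ ν x
      F⊆G (x∈P , cx≡b) with x μ ν ℚₚ.≟ 0ℚ
      ... | yes x≡0 = x∈P , dot-negUnit≡0 μ ν x x≡0
      ... | no  x≢0 = ⊥-elim (proj₂ dimF (x ∷ p , (λ { zero → x∈P , cx≡b ; (suc j) → p∈F j }) ,
                        affIndep-∷ p-indep (negUnit μ ν) 0ℚ p∈G x (x≢0 ∘ dot-negUnit≡0⇒≡0 μ ν x)))
      ¬indepG : ¬ HasAffIndep (CoordinateFace P μ ν) (suc k)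
      ¬indepG = ¬affIndep-section {P = P} {G = CoordinateFace P μ ν} (λ _ → proj₁) (negUnit μ ν) 0ℚ (λ _ → proj₂) y∈P
                  (y≢0 ∘ dot-negUnit≡0⇒≡0 μ ν y) (proj₂ dimP)
      G⊆F : CoordinateFace P μ ν x → F x
      G⊆F (x∈P , x∈G) with dot c x ℚₚ.≟ b
      ... | yes cx≡b = x∈P , cx≡b
      ... | no  cx≢b = ⊥-elim (¬indepG (x ∷ p , (λ { zero → x∈P , x∈G ; (suc j) → proj₁ (p∈F j) , p∈G j }) ,
                         affIndep-∷ p-indep c b (λ j → proj₂ (p∈F j)) x cx≢b))

  facet⇒coordinateFace : ∀ {y} → P y → (∀ μ ν → 0ℚ < y μ ν) →
    ∀ {c b} → IsFacet P c b → ∃₂ λ μ ν → SameSet (FaceOf P c b) (CoordinateFace P μ ν)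
  facet⇒coordinateFace y∈P 0<y {c} {b} (valid , k , dimP , dimF@((p , _) , _))
    with Finₚ.any? (λ μ → Finₚ.any? (λ ν → Finₚ.all? (λ j → p j μ ν ℚₚ.≟ 0ℚ)))
  ... | yes (μ , ν , p≡0) = μ , ν ,
    facet-vanishing⇒coordinateFace {c} {b} valid dimP dimF y∈P μ ν (λ y≡0 → ℚₚ.<⇒≢ (0<y μ ν) (sym y≡0)) p≡0
  ... | no  ¬vanishing    = ⊥-elim (facet-vanishes-somewhere {c} {b} valid dimP dimF (λ μ ν →
    Finₚ.¬∀⟶∃¬ _ _ (λ j → p j μ ν ℚₚ.≟ 0ℚ) (λ p≡0 → ¬vanishing (μ , ν , p≡0))))

-- Dimension of a transportation polytope

module _ {m' n' : ℕ} (s : Fin (suc m') → ℚ) (t : Fin (suc n') → ℚ) where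

  private
    P : SubsetM (suc m') (suc n')
    P = Transport s t

  zeroMargins-lowerBlock : ∀ {Z : Mat (suc m') (suc n')} → ZeroMargins Z →
    (∀ a b → Z (suc a) (suc b) ≡ 0ℚ) → ∀ μ ν → Z μ ν ≡ 0ℚ
  zeroMargins-lowerBlock {Z} (rows , cols) block≡0 = Z≡0
    where
    head≡0 : ∀ {k} (f : Fin (suc k) → ℚ) → Σℚ f ≡ 0ℚ → (∀ i → f (suc i) ≡ 0ℚ) → f zero ≡ 0ℚ
    head≡0 f Σf≡0 tail≡0 = trans (sym (ℚₚ.+-identityʳ (f zero)))
                                (trans (cong (f zero +_) (sym (Σℚ-zero (f ∘ suc) tail≡0))) Σf≡0)
    lowerRows≡0 : ∀ a ν → Z (suc a) ν ≡ 0ℚ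
    lowerRows≡0 a zero    = head≡0 (Z (suc a)) (rows (suc a)) (block≡0 a)
    lowerRows≡0 a (suc b) = block≡0 a b
    Z≡0 : ∀ μ ν → Z μ ν ≡ 0ℚ
    Z≡0 zero    ν = head≡0 (λ μ → Z μ ν) (cols ν) (λ a → lowerRows≡0 a ν)
    Z≡0 (suc a) ν = lowerRows≡0 a ν

  -- An affine dependence among the lower-right blocks of m'n' + 2 points extends to the
  -- whole matrices, since a matrix with zero margins is determined by that block.
  ¬affIndep-transport : ¬ HasAffIndep P (suc (m' ℕ.* n'))
  ¬affIndep-transport (p , p∈P , indep) = λsᵢ≢0 (indep λs Σλ≡0 combination≡0 i)
    where
    blocks : Fin (suc (suc (m' ℕ.* n'))) → Fin (suc (m' ℕ.* n')) → ℚ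
    blocks i zero    = 1ℚ
    blocks i (suc c) = p i (suc (proj₁ (Fin.remQuot {m'} n' c))) (suc (proj₂ (Fin.remQuot {m'} n' c)))
    dependence = linearDependence (suc (m' ℕ.* n')) blocks
    λs = proj₁ dependence
    i = proj₁ (proj₁ (proj₂ dependence))
    λsᵢ≢0 = proj₂ (proj₁ (proj₂ dependence))
    λs·blocks≡0 = proj₂ (proj₂ dependence)
    Σλ≡0 : Σℚ λs ≡ 0ℚ
    Σλ≡0 = trans (Σℚ-cong (λ i → sym (ℚₚ.*-identityʳ (λs i)))) (λs·blocks≡0 zero)
    block≡0 : ∀ a b → combination λs p (suc a) (suc b) ≡ 0ℚ
    block≡0 a b = subst (λ ab → combination λs p (suc (proj₁ ab)) (suc (proj₂ ab)) ≡ 0ℚ)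
                    (Finₚ.remQuot-combine {m'} {n'} a b) (λs·blocks≡0 (suc (Fin.combine a b)))
    combination≡0 : ∀ μ ν → combination λs p μ ν ≡ 0ℚ
    combination≡0 = zeroMargins-lowerBlock (zeroMargins-combination s t λs p p∈P Σλ≡0) block≡0

  -- Moving q units around the rectangle with corners (a, b) and (L, C).
  module Star (L : Fin (suc m')) (C : Fin (suc n')) (q : ℚ) where

    rowDiff : Fin m' → Fin (suc m') → ℚ
    rowDiff a μ = δ (punchIn L a) μ - δ L μ

    colDiff : Fin n' → Fin (suc n') → ℚ
    colDiff b ν = δ (punchIn C b) ν - δ C ν

    perturbation : Fin m' × Fin n' → Mat (suc m') (suc n')
    perturbation (a , b) μ ν = q * (rowDiff a μ * colDiff b ν)

    perturbation-zeroMargins : ∀ ab → ZeroMargins (perturbation ab)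
    perturbation-zeroMargins (a , b) = zeroMargins-scale q {λ μ ν → rowDiff a μ * colDiff b ν}
      (zeroMargins-outer (rowDiff a) (colDiff b) (Σℚ-δ-δ (punchIn L a) L) (Σℚ-δ-δ (punchIn C b) C))

    0≤+perturbation : 0ℚ ≤ q → ∀ {x} ab μ ν → q ≤ x → 0ℚ ≤ x + perturbation ab μ ν
    0≤+perturbation 0≤q {x} (a , b) μ ν q≤x = begin
      0ℚ              ≡⟨ solve 1 (λ q → q :+ q :* (:- con 1ℚ) := con 0ℚ) refl q ⟨
      q + q * - 1ℚ    ≤⟨ ℚₚ.+-mono-≤ q≤x (ℚₚ.*-monoˡ-≤-nonNeg q {{ℚ.nonNegative 0≤q}}
                            (-1≤sign*sign (δ-δ-sign (punchIn L a) L μ) (δ-δ-sign (punchIn C b) C ν))) ⟩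
      x + perturbation (a , b) μ ν ∎
      where open ℚₚ.≤-Reasoning

    private
      δ-δ-punchIn : ∀ {k} (L : Fin (suc k)) a a' →
        δ (punchIn L a) (punchIn L a') - δ L (punchIn L a') ≡ δ (punchIn L a) (punchIn L a')
      δ-δ-punchIn L a a' = trans (cong (δ (punchIn L a) (punchIn L a') +_) (cong -_ (δ-≢ (Finₚ.punchInᵢ≢i L a' ∘ sym))))
                                 (ℚₚ.+-identityʳ (δ (punchIn L a) (punchIn L a')))

    perturbation-own : ∀ ab → perturbation ab (punchIn L (proj₁ ab)) (punchIn C (proj₂ ab)) ≡ q
    perturbation-own (a , b) = trans
      (cong₂ (λ u v → q * (u * v)) (trans (δ-δ-punchIn L a a) (δ-refl (punchIn L a)))
                                   (trans (δ-δ-punchIn C b b) (δ-refl (punchIn C b))))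
      (ℚₚ.*-identityʳ q)

    perturbation-other : ∀ ab ab' → ab ≢ ab' → perturbation ab (punchIn L (proj₁ ab')) (punchIn C (proj₂ ab')) ≡ 0ℚ
    perturbation-other (a , b) (a' , b') ab≢ab' with a Finₚ.≟ a' | b Finₚ.≟ b'
    ... | yes refl | yes refl = ⊥-elim (ab≢ab' refl)
    ... | no a≢a'  | _        = begin
      q * (rowDiff a (punchIn L a') * v)  ≡⟨ cong (λ u → q * (u * v)) (trans (δ-δ-punchIn L a a') (δ-≢ (a≢a' ∘ Finₚ.punchIn-injective L a a'))) ⟩
      q * (0ℚ * v)                        ≡⟨ cong (q *_) (ℚₚ.*-zeroˡ v) ⟩
      q * 0ℚ                              ≡⟨ ℚₚ.*-zeroʳ q ⟩
      0ℚ                                  ∎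
      where
      open ≡-Reasoning
      v = colDiff b (punchIn C b')
    ... | yes _    | no b≢b'  = begin
      q * (u * colDiff b (punchIn C b'))  ≡⟨ cong (λ v → q * (u * v)) (trans (δ-δ-punchIn C b b') (δ-≢ (b≢b' ∘ Finₚ.punchIn-injective C b b'))) ⟩
      q * (u * 0ℚ)                        ≡⟨ cong (q *_) (ℚₚ.*-zeroʳ u) ⟩
      q * 0ℚ                              ≡⟨ ℚₚ.*-zeroʳ q ⟩
      0ℚ                                  ∎
      where
      open ≡-Reasoning
      u = rowDiff a (punchIn L a')

    star : ∀ {K} → Mat (suc m') (suc n') → (Fin K → Fin m' × Fin n') → Fin (suc K) → Mat (suc m') (suc n')
    star x g = x ∷ λ j μ ν → x μ ν + perturbation (g j) μ ν

    star-∈ : ∀ {K x} (g : Fin K → Fin m' × Fin n') → P x →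
      (∀ j μ ν → 0ℚ ≤ x μ ν + perturbation (g j) μ ν) → ∀ i → P (star x g i)
    star-∈ g x∈P 0≤x+E zero    = x∈P
    star-∈ g x∈P 0≤x+E (suc j) = transport-shift s t x∈P (perturbation-zeroMargins (g j)) (0≤x+E j)

    star-affIndep : ∀ {K} x (g : Fin K → Fin m' × Fin n') → (∀ {i j} → g i ≡ g j → i ≡ j) → q ≢ 0ℚ →
      AffIndep (star x g)
    star-affIndep x g g-injective q≢0 = affIndep-star x (perturbation ∘ g)
      (λ j → punchIn L (proj₁ (g j))) (λ j → punchIn C (proj₂ (g j))) q≢0
      (λ j → perturbation-own (g j)) (λ i j j≢i → perturbation-other (g j) (g i) (j≢i ∘ g-injective))

  remQuot-injective : ∀ {i j : Fin (m' ℕ.* n')} → Fin.remQuot {m'} n' i ≡ Fin.remQuot {m'} n' j → i ≡ j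
  remQuot-injective {i} {j} eq = trans (sym (Finₚ.combine-remQuot {m'} n' i))
    (trans (cong (λ ab → Fin.combine (proj₁ ab) (proj₂ ab)) eq) (Finₚ.combine-remQuot {m'} n' j))

  transport-dim : ∀ {q} → 0ℚ < q → ∀ {y} → P y → (∀ μ ν → q ≤ y μ ν) → HasDim P (m' ℕ.* n')
  transport-dim {q} 0<q {y} y∈P q≤y =
    (star y (Fin.remQuot n') ,
     star-∈ (Fin.remQuot n') y∈P (λ j μ ν → 0≤+perturbation (ℚₚ.<⇒≤ 0<q) (Fin.remQuot n' j) μ ν (q≤y μ ν)) ,
     star-affIndep y (Fin.remQuot n') remQuot-injective (ℚₚ.<⇒≢ 0<q ∘ sym)) ,
    ¬affIndep-transport
    where open Star zero zero q

module _ {m'' n'' : ℕ} (s : Fin (suc (suc m'')) → ℚ) (t : Fin (suc (suc n'')) → ℚ) where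

  private
    P : SubsetM (suc (suc m'')) (suc (suc n''))
    P = Transport s t
    m' = suc m''
    n' = suc n''

  coordinateFace-affIndep : ∀ {q} → 0ℚ < q → ∀ {r} → P r → ∀ μ₀ ν₀ → r μ₀ ν₀ ≡ 0ℚ →
    (∀ μ ν → ¬ (μ ≡ μ₀ × ν ≡ ν₀) → q ≤ r μ ν) → HasAffIndep (CoordinateFace P μ₀ ν₀) (n'' ℕ.+ m'' ℕ.* n')
  coordinateFace-affIndep {q} 0<q {r} r∈P μ₀ ν₀ r₀≡0 q≤r =
    star r g , star∈face , star-affIndep r g g-injective (ℚₚ.<⇒≢ 0<q ∘ sym)
    where
    L = punchIn μ₀ zero
    C = punchIn ν₀ zero
    open Star s t L C q
    L≢μ₀ = Finₚ.punchInᵢ≢i μ₀ zero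
    C≢ν₀ = Finₚ.punchInᵢ≢i ν₀ zero
    corner : Fin m' × Fin n'
    corner = punchOut L≢μ₀ , punchOut C≢ν₀
    j₀ : Fin (m' ℕ.* n')
    j₀ = Fin.combine (proj₁ corner) (proj₂ corner)
    g : Fin (n'' ℕ.+ m'' ℕ.* n') → Fin m' × Fin n'
    g j = Fin.remQuot n' (punchIn j₀ j)
    g-injective : ∀ {i j} → g i ≡ g j → i ≡ j
    g-injective {i} {j} = Finₚ.punchIn-injective j₀ i j ∘ remQuot-injective s t
    g≢corner : ∀ j → g j ≢ corner
    g≢corner j gj≡corner = Finₚ.punchInᵢ≢i j₀ j
      (remQuot-injective s t (trans gj≡corner (sym (Finₚ.remQuot-combine (proj₁ corner) (proj₂ corner)))))
    perturbation-at-corner : ∀ j → perturbation (g j) μ₀ ν₀ ≡ 0ℚ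
    perturbation-at-corner j = subst₂ (λ μ ν → perturbation (g j) μ ν ≡ 0ℚ)
      (Finₚ.punchIn-punchOut L≢μ₀) (Finₚ.punchIn-punchOut C≢ν₀) (perturbation-other (g j) corner (g≢corner j))
    r+E₀≡0 : ∀ j → r μ₀ ν₀ + perturbation (g j) μ₀ ν₀ ≡ 0ℚ
    r+E₀≡0 j = trans (cong₂ _+_ r₀≡0 (perturbation-at-corner j)) (ℚₚ.+-identityʳ 0ℚ)
    0≤r+E : ∀ j μ ν → 0ℚ ≤ r μ ν + perturbation (g j) μ ν
    0≤r+E j μ ν with (μ Finₚ.≟ μ₀) ×-dec (ν Finₚ.≟ ν₀)
    ... | yes (refl , refl) = ℚₚ.≤-reflexive (sym (r+E₀≡0 j))
    ... | no  off-corner    = 0≤+perturbation (ℚₚ.<⇒≤ 0<q) (g j) μ ν (q≤r μ ν off-corner)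
    star∈face : ∀ i → CoordinateFace P μ₀ ν₀ (star r g i)
    star∈face zero    = r∈P , dot-negUnit≡0 μ₀ ν₀ r r₀≡0
    star∈face (suc j) = star-∈ g r∈P 0≤r+E (suc j) , dot-negUnit≡0 μ₀ ν₀ (star r g (suc j)) (r+E₀≡0 j)

  coordinateFace-isFacet : ∀ {q} → 0ℚ < q → ∀ {y} → P y → (∀ μ ν → q ≤ y μ ν) →
    ∀ {r} → P r → ∀ μ₀ ν₀ → r μ₀ ν₀ ≡ 0ℚ → (∀ μ ν → ¬ (μ ≡ μ₀ × ν ≡ ν₀) → q ≤ r μ ν) →
    IsFacet P (negUnit μ₀ ν₀) 0ℚ
  coordinateFace-isFacet 0<q {y} y∈P q≤y r∈P μ₀ ν₀ r₀≡0 q≤r =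
    negUnit-valid s t μ₀ ν₀ , _ , dimP ,
    coordinateFace-affIndep 0<q r∈P μ₀ ν₀ r₀≡0 q≤r ,
    ¬affIndep-section {P = P} {G = CoordinateFace P μ₀ ν₀} (λ _ → proj₁) (negUnit μ₀ ν₀) 0ℚ (λ _ → proj₂) y∈P
      (λ y₀≡0 → ℚₚ.<⇒≢ (ℚₚ.<-≤-trans 0<q (q≤y μ₀ ν₀)) (sym (dot-negUnit≡0⇒≡0 μ₀ ν₀ y y₀≡0))) (proj₂ dimP)
    where dimP = transport-dim s t 0<q y∈P q≤y

numFacets-coordinate : ∀ {m n} (P : SubsetM m n) →
  (∀ μ ν → IsFacet P (negUnit μ ν) 0ℚ) →
  (∀ μ ν → ∃ λ r → CoordinateFace P μ ν r × (∀ μ' ν' → ¬ (μ' ≡ μ × ν' ≡ ν) → r μ' ν' ≢ 0ℚ)) →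
  (∀ c b → IsFacet P c b → ∃₂ λ μ ν → SameSet (FaceOf P c b) (CoordinateFace P μ ν)) →
  NumFacets P (m ℕ.* n)
numFacets-coordinate {m} {n} P isFacet witness facet⇒coordinate = facets , facets-isFacet , distinct , complete
  where
  index : Fin (m ℕ.* n) → Fin m × Fin n
  index = Fin.remQuot n
  facets : Fin (m ℕ.* n) → Mat m n × ℚ
  facets i = negUnit (proj₁ (index i)) (proj₂ (index i)) , 0ℚ
  facets-isFacet : ∀ i → IsFacet P (proj₁ (facets i)) (proj₂ (facets i))
  facets-isFacet i = isFacet (proj₁ (index i)) (proj₂ (index i))
  same-coordinate : ∀ μ ν μ' ν' → SameSet (CoordinateFace P μ ν) (CoordinateFace P μ' ν') → (μ , ν) ≡ (μ' , ν')
  same-coordinate μ ν μ' ν' same with (μ' Finₚ.≟ μ) ×-dec (ν' Finₚ.≟ ν)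
  ... | yes (refl , refl) = refl
  ... | no  different     = ⊥-elim (proj₂ (proj₂ (witness μ ν)) μ' ν' different
          (dot-negUnit≡0⇒≡0 μ' ν' r (proj₂ (proj₁ (same r) (proj₁ (proj₂ (witness μ ν)))))))
    where r = proj₁ (witness μ ν)
  distinct : ∀ i j → SameSet (CoordinateFace P (proj₁ (index i)) (proj₂ (index i)))
                             (CoordinateFace P (proj₁ (index j)) (proj₂ (index j))) → i ≡ j
  distinct i j same = trans (sym (Finₚ.combine-remQuot {m} n i))
    (trans (cong (λ ab → Fin.combine (proj₁ ab) (proj₂ ab)) (same-coordinate _ _ _ _ same)) (Finₚ.combine-remQuot {m} n j))
  complete : ∀ c b → IsFacet P c b → ∃ λ i → SameSet (FaceOf P c b) (CoordinateFace P (proj₁ (index i)) (proj₂ (index i)))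
  complete c b facet with facet⇒coordinate c b facet
  ... | μ , ν , same = Fin.combine μ ν ,
    subst (λ ab → SameSet (FaceOf P c b) (CoordinateFace P (proj₁ ab) (proj₂ ab))) (sym (Finₚ.remQuot-combine μ ν)) same

-- The polytope P_d

1+ma<[a+b][1+mb] : ∀ m₁ a {b} → 1 ℕ.≤ b → suc (suc m₁ ℕ.* a) ℕ.< (a ℕ.+ b) ℕ.* suc (suc m₁ ℕ.* b)
1+ma<[a+b][1+mb] m₁ a {b} 1≤b = begin
  suc (suc (suc m₁ ℕ.* a))             ≤⟨ ℕₚ.m≤m+n _ (a ℕ.+ m₁) ⟩
  suc (suc (suc m₁ ℕ.* a)) ℕ.+ (a ℕ.+ m₁) ≡⟨ ℕS.solve 2 (λ m a → ℕS.con 2 ℕS.:+ (ℕS.con 1 ℕS.:+ m) ℕS.:* a ℕS.:+ (a ℕS.:+ m)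
                                                         ℕS.:= (a ℕS.:+ ℕS.con 1) ℕS.:* (ℕS.con 2 ℕS.:+ m)) refl m₁ a ⟩
  (a ℕ.+ 1) ℕ.* suc (suc m₁)           ≤⟨ ℕₚ.*-mono-≤ (ℕₚ.+-monoʳ-≤ a 1≤b) (s≤s (ℕₚ.≤-trans (ℕₚ.≤-reflexive (sym (ℕₚ.*-identityʳ (suc m₁)))) (ℕₚ.*-monoʳ-≤ (suc m₁) 1≤b))) ⟩
  (a ℕ.+ b) ℕ.* suc (suc m₁ ℕ.* b)     ∎
  where open ℕₚ.≤-Reasoning

module _ {m'' n'' : ℕ} (d : Fin (suc (suc m'')) → ℕ) (Σd≡n' : Σℕ d ≡ suc n'')
         {μ₁ μ₂ : Fin (suc (suc m''))} (μ₁≢μ₂ : μ₁ ≢ μ₂) (1≤d₁ : 1 ℕ.≤ d μ₁) (1≤d₂ : 1 ℕ.≤ d μ₂) where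

  private
    m n' n : ℕ
    m = suc (suc m'')
    n' = suc n''
    n = suc n'
    S : Fin m → ℕ
    S μ = suc (m ℕ.* d μ)
    s : Fin m → ℚ
    s = ℕ→ℚ ∘ S
    t : Fin n → ℚ
    t _ = ℕ→ℚ m
    P : SubsetM m n
    P = Transport s t

    -- q = 1 / (n (n - 1)); every point used below has coordinates in ℕ q.
    0<nn' : 0ℚ < ℕ→ℚ (n ℕ.* n')
    0<nn' = 0<ℕ→ℚ[1+n] (n'' ℕ.+ n' ℕ.* n')
    q : ℚ
    q = recip 0<nn'
    0<q : 0ℚ < q
    0<q = 0<recip 0<nn'
    nn'q≡1 : ℕ→ℚ (n ℕ.* n') * q ≡ 1ℚ
    nn'q≡1 = *-recip 0<nn'

    q≤N*q : ∀ N → 1 ℕ.≤ N → q ≤ ℕ→ℚ N * q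
    q≤N*q N 1≤N = begin
      q             ≡⟨ ℚₚ.*-identityˡ q ⟨
      1ℚ * q        ≤⟨ ℚₚ.*-monoʳ-≤-nonNeg q {{ℚ.nonNegative (ℚₚ.<⇒≤ 0<q)}} (ℕ→ℚ-mono-≤ 1≤N) ⟩
      ℕ→ℚ N * q     ∎
      where open ℚₚ.≤-Reasoning

    y : Mat m n
    y μ ν = ℕ→ℚ (n' ℕ.* S μ) * q

    q≤y : ∀ μ ν → q ≤ y μ ν
    q≤y μ ν = q≤N*q (n' ℕ.* S μ) (s≤s z≤n)

    y∈P : P y
    y∈P = (λ μ ν → ℚₚ.≤-trans (ℚₚ.<⇒≤ 0<q) (q≤y μ ν)) , rows , cols
      where
      open ≡-Reasoning
      rearrange : ∀ a b c e → a * (b * c * e) ≡ c * ((a * b) * e)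
      rearrange = solve 4 (λ a b c e → a :* (b :* c :* e) := c :* ((a :* b) :* e)) refl
      rows : ∀ μ → Σℚ (y μ) ≡ s μ
      rows μ = begin
        Σℚ (y μ)                              ≡⟨ Σℚ-const {n} (ℕ→ℚ (n' ℕ.* S μ) * q) ⟩
        ℕ→ℚ n * (ℕ→ℚ (n' ℕ.* S μ) * q)        ≡⟨ cong (λ a → ℕ→ℚ n * (a * q)) (ℕ→ℚ-homo-* n' (S μ)) ⟩
        ℕ→ℚ n * (ℕ→ℚ n' * s μ * q)            ≡⟨ rearrange (ℕ→ℚ n) (ℕ→ℚ n') (s μ) q ⟩
        s μ * ((ℕ→ℚ n * ℕ→ℚ n') * q)          ≡⟨ cong (λ a → s μ * (a * q)) (ℕ→ℚ-homo-* n n') ⟨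
        s μ * (ℕ→ℚ (n ℕ.* n') * q)            ≡⟨ cong (s μ *_) nn'q≡1 ⟩
        s μ * 1ℚ                              ≡⟨ ℚₚ.*-identityʳ (s μ) ⟩
        s μ                                   ∎
      ΣS : n' ℕ.* Σℕ S ≡ m ℕ.* (n ℕ.* n')
      ΣS = begin
        n' ℕ.* Σℕ S                 ≡⟨ cong (n' ℕ.*_) (trans (Σℕ-suc (λ μ → m ℕ.* d μ)) (cong (m ℕ.+_) (Σℕ-factorˡ m d))) ⟩
        n' ℕ.* (m ℕ.+ m ℕ.* Σℕ d)   ≡⟨ cong (λ a → n' ℕ.* (m ℕ.+ m ℕ.* a)) Σd≡n' ⟩
        n' ℕ.* (m ℕ.+ m ℕ.* n')     ≡⟨ ℕS.solve 2 (λ a b → b ℕS.:* (a ℕS.:+ a ℕS.:* b) ℕS.:= a ℕS.:* ((ℕS.con 1 ℕS.:+ b) ℕS.:* b)) refl m n' ⟩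
        m ℕ.* (n ℕ.* n')            ∎
      cols : ∀ ν → Σℚ (λ μ → y μ ν) ≡ t ν
      cols ν = begin
        Σℚ (λ μ → y μ ν)                    ≡⟨ Σℚ-factorʳ q (λ μ → ℕ→ℚ (n' ℕ.* S μ)) ⟩
        Σℚ (λ μ → ℕ→ℚ (n' ℕ.* S μ)) * q     ≡⟨ cong (_* q) (Σℚ-ℕ→ℚ (λ μ → n' ℕ.* S μ)) ⟩
        ℕ→ℚ (Σℕ (λ μ → n' ℕ.* S μ)) * q     ≡⟨ cong (λ a → ℕ→ℚ a * q) (trans (Σℕ-factorˡ n' S) ΣS) ⟩
        ℕ→ℚ (m ℕ.* (n ℕ.* n')) * q          ≡⟨ cong (_* q) (ℕ→ℚ-homo-* m (n ℕ.* n')) ⟩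
        ℕ→ℚ m * ℕ→ℚ (n ℕ.* n') * q          ≡⟨ ℚₚ.*-assoc (ℕ→ℚ m) (ℕ→ℚ (n ℕ.* n')) q ⟩
        ℕ→ℚ m * (ℕ→ℚ (n ℕ.* n') * q)        ≡⟨ cong (ℕ→ℚ m *_) nn'q≡1 ⟩
        ℕ→ℚ m * 1ℚ                          ≡⟨ ℚₚ.*-identityʳ (ℕ→ℚ m) ⟩
        ℕ→ℚ m                               ∎

    heavyRow : ∀ μ₀ → ∃ λ L → L ≢ μ₀ × 1 ℕ.≤ d L
    heavyRow μ₀ with μ₁ Finₚ.≟ μ₀
    ... | yes refl  = μ₂ , μ₁≢μ₂ ∘ sym , 1≤d₂
    ... | no μ₁≢μ₀ = μ₁ , μ₁≢μ₀ , 1≤d₁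

    0<y : ∀ μ ν → 0ℚ < y μ ν
    0<y μ ν = ℚₚ.<-≤-trans 0<q (q≤y μ ν)

    y-split : ∀ μ ν → y μ ν ≡ ℕ→ℚ n' * s μ * q
    y-split μ ν = cong (_* q) (ℕ→ℚ-homo-* n' (S μ))

    -- r = y + α (e μ₀ - e L) ⊗ (1 - n e ν₀) empties the corner (μ₀, ν₀); d L ≥ 1 keeps r L ν > 0.
    module Corner (μ₀ : Fin m) (ν₀ : Fin n) where

      L : Fin m
      L = proj₁ (heavyRow μ₀)
      L≢μ₀ : L ≢ μ₀
      L≢μ₀ = proj₁ (proj₂ (heavyRow μ₀))

      rowShift : Fin m → ℚ
      rowShift μ = δ μ₀ μ - δ L μ

      colShift : Fin n → ℚ
      colShift ν = 1ℚ - ℕ→ℚ n * δ ν₀ ν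

      α : ℚ
      α = s μ₀ * q

      r : Mat m n
      r μ ν = y μ ν + α * (rowShift μ * colShift ν)

      Σ-colShift : Σℚ colShift ≡ 0ℚ
      Σ-colShift = begin
        Σℚ (λ ν → 1ℚ + - (ℕ→ℚ n * δ ν₀ ν))              ≡⟨ Σℚ-distrib-+ (λ _ → 1ℚ) (λ ν → - (ℕ→ℚ n * δ ν₀ ν)) ⟩
        Σℚ {n} (λ _ → 1ℚ) + Σℚ (λ ν → - (ℕ→ℚ n * δ ν₀ ν)) ≡⟨ cong₂ _+_ (Σℚ-const {n} 1ℚ) (Σℚ-neg (λ ν → ℕ→ℚ n * δ ν₀ ν)) ⟩
        ℕ→ℚ n * 1ℚ - Σℚ (λ ν → ℕ→ℚ n * δ ν₀ ν)          ≡⟨ cong (λ a → ℕ→ℚ n * 1ℚ - a) (Σℚ-factorˡ (ℕ→ℚ n) (δ ν₀)) ⟩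
        ℕ→ℚ n * 1ℚ - ℕ→ℚ n * Σℚ (δ ν₀)                  ≡⟨ cong (λ a → ℕ→ℚ n * 1ℚ - ℕ→ℚ n * a) (trans (Σℚ-cong (λ ν → sym (ℚₚ.*-identityˡ (δ ν₀ ν)))) (Σℚ-δ ν₀ (λ _ → 1ℚ))) ⟩
        ℕ→ℚ n * 1ℚ - ℕ→ℚ n * 1ℚ                         ≡⟨ ℚₚ.+-inverseʳ (ℕ→ℚ n * 1ℚ) ⟩
        0ℚ                                              ∎
        where open ≡-Reasoning

      rowShift-μ₀ : rowShift μ₀ ≡ 1ℚ
      rowShift-μ₀ = cong₂ _-_ (δ-refl μ₀) (δ-≢ L≢μ₀)

      rowShift-L : rowShift L ≡ - 1ℚ
      rowShift-L = cong₂ _-_ (δ-≢ (L≢μ₀ ∘ sym)) (δ-refl L)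

      rowShift-other : ∀ {μ} → μ ≢ μ₀ → μ ≢ L → rowShift μ ≡ 0ℚ
      rowShift-other μ≢μ₀ μ≢L = cong₂ _-_ (δ-≢ (μ≢μ₀ ∘ sym)) (δ-≢ (μ≢L ∘ sym))

      colShift-ν₀ : colShift ν₀ ≡ - ℕ→ℚ n'
      colShift-ν₀ = begin
        1ℚ - ℕ→ℚ n * δ ν₀ ν₀     ≡⟨ cong (λ a → 1ℚ - ℕ→ℚ n * a) (δ-refl ν₀) ⟩
        1ℚ - ℕ→ℚ n * 1ℚ          ≡⟨ cong (λ a → 1ℚ - a * 1ℚ) (ℕ→ℚ-suc n') ⟩
        1ℚ - (1ℚ + ℕ→ℚ n') * 1ℚ  ≡⟨ solve 1 (λ a → con 1ℚ :- (con 1ℚ :+ a) :* con 1ℚ := :- a) refl (ℕ→ℚ n') ⟩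
        - ℕ→ℚ n'                 ∎
        where open ≡-Reasoning

      colShift-other : ∀ {ν} → ν ≢ ν₀ → colShift ν ≡ 1ℚ
      colShift-other ν≢ν₀ = trans (cong (λ a → 1ℚ - ℕ→ℚ n * a) (δ-≢ (ν≢ν₀ ∘ sym)))
                                  (cong (λ a → 1ℚ - a) (ℚₚ.*-zeroʳ (ℕ→ℚ n)))

      r-at : ∀ μ ν {u v} → rowShift μ ≡ u → colShift ν ≡ v → r μ ν ≡ ℕ→ℚ n' * s μ * q + s μ₀ * q * (u * v)
      r-at μ ν ≡u ≡v = cong₂ (λ a b → a + α * b) (y-split μ ν) (cong₂ _*_ ≡u ≡v)

      r-corner : r μ₀ ν₀ ≡ 0ℚ
      r-corner = trans (r-at μ₀ ν₀ rowShift-μ₀ colShift-ν₀)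
        (solve 3 (λ a b c → a :* b :* c :+ b :* c :* (con 1ℚ :* (:- a)) := con 0ℚ) refl (ℕ→ℚ n') (s μ₀) q)

      r-row : ∀ {ν} → ν ≢ ν₀ → r μ₀ ν ≡ ℕ→ℚ (n ℕ.* S μ₀) * q
      r-row {ν} ν≢ν₀ = begin
        r μ₀ ν                                       ≡⟨ r-at μ₀ ν rowShift-μ₀ (colShift-other ν≢ν₀) ⟩
        ℕ→ℚ n' * s μ₀ * q + s μ₀ * q * (1ℚ * 1ℚ)     ≡⟨ solve 3 (λ a b c → a :* b :* c :+ b :* c :* (con 1ℚ :* con 1ℚ) := (con 1ℚ :+ a) :* b :* c) refl (ℕ→ℚ n') (s μ₀) q ⟩
        (1ℚ + ℕ→ℚ n') * s μ₀ * q                     ≡⟨ cong (λ a → a * s μ₀ * q) (ℕ→ℚ-suc n') ⟨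
        ℕ→ℚ n * s μ₀ * q                             ≡⟨ cong (_* q) (ℕ→ℚ-homo-* n (S μ₀)) ⟨
        ℕ→ℚ (n ℕ.* S μ₀) * q                         ∎
        where open ≡-Reasoning

      r-column : r L ν₀ ≡ ℕ→ℚ (n' ℕ.* S L ℕ.+ n' ℕ.* S μ₀) * q
      r-column = begin
        r L ν₀                                                 ≡⟨ r-at L ν₀ rowShift-L colShift-ν₀ ⟩
        ℕ→ℚ n' * s L * q + s μ₀ * q * (- 1ℚ * - ℕ→ℚ n')        ≡⟨ solve 4 (λ a b c e → a :* b :* c :+ e :* c :* (:- con 1ℚ :* :- a) := (a :* b :+ a :* e) :* c) refl (ℕ→ℚ n') (s L) q (s μ₀) ⟩
        (ℕ→ℚ n' * s L + ℕ→ℚ n' * s μ₀) * q                     ≡⟨ cong (_* q) (cong₂ _+_ (ℕ→ℚ-homo-* n' (S L)) (ℕ→ℚ-homo-* n' (S μ₀))) ⟨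
        (ℕ→ℚ (n' ℕ.* S L) + ℕ→ℚ (n' ℕ.* S μ₀)) * q             ≡⟨ cong (_* q) (ℕ→ℚ-homo-+ (n' ℕ.* S L) (n' ℕ.* S μ₀)) ⟨
        ℕ→ℚ (n' ℕ.* S L ℕ.+ n' ℕ.* S μ₀) * q                   ∎
        where open ≡-Reasoning

      S₀<n'S[L] : S μ₀ ℕ.< n' ℕ.* S L
      S₀<n'S[L] = ℕₚ.<-≤-trans (1+ma<[a+b][1+mb] (suc m'') (d μ₀) (proj₂ (proj₂ (heavyRow μ₀))))
                    (ℕₚ.*-monoˡ-≤ (S L) (subst (d μ₀ ℕ.+ d L ℕ.≤_) Σd≡n' (two-terms≤Σℕ d (L≢μ₀ ∘ sym))))

      r-heavyRow : ∀ {ν} → ν ≢ ν₀ → r L ν ≡ ℕ→ℚ (n' ℕ.* S L ℕ.∸ S μ₀) * q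
      r-heavyRow {ν} ν≢ν₀ = begin
        r L ν                                           ≡⟨ r-at L ν rowShift-L (colShift-other ν≢ν₀) ⟩
        ℕ→ℚ n' * s L * q + s μ₀ * q * (- 1ℚ * 1ℚ)       ≡⟨ cong (λ a → a * q + s μ₀ * q * (- 1ℚ * 1ℚ)) n's[L]≡ ⟩
        (s μ₀ + ℕ→ℚ e) * q + s μ₀ * q * (- 1ℚ * 1ℚ)     ≡⟨ solve 3 (λ a b c → (a :+ b) :* c :+ a :* c :* (:- con 1ℚ :* con 1ℚ) := b :* c) refl (s μ₀) (ℕ→ℚ e) q ⟩
        ℕ→ℚ e * q                                       ∎
        where
        open ≡-Reasoning
        e = n' ℕ.* S L ℕ.∸ S μ₀
        n's[L]≡ : ℕ→ℚ n' * s L ≡ s μ₀ + ℕ→ℚ e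
        n's[L]≡ = trans (sym (ℕ→ℚ-homo-* n' (S L)))
                        (trans (cong ℕ→ℚ (sym (ℕₚ.m+[n∸m]≡n (ℕₚ.<⇒≤ S₀<n'S[L])))) (ℕ→ℚ-homo-+ (S μ₀) e))

      r-elsewhere : ∀ {μ ν} → μ ≢ μ₀ → μ ≢ L → r μ ν ≡ y μ ν
      r-elsewhere {μ} {ν} μ≢μ₀ μ≢L = begin
        y μ ν + α * (rowShift μ * colShift ν)   ≡⟨ cong (λ a → y μ ν + α * (a * colShift ν)) (rowShift-other μ≢μ₀ μ≢L) ⟩
        y μ ν + α * (0ℚ * colShift ν)           ≡⟨ cong (λ a → y μ ν + α * a) (ℚₚ.*-zeroˡ (colShift ν)) ⟩
        y μ ν + α * 0ℚ                          ≡⟨ cong (y μ ν +_) (ℚₚ.*-zeroʳ α) ⟩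
        y μ ν + 0ℚ                              ≡⟨ ℚₚ.+-identityʳ (y μ ν) ⟩
        y μ ν                                   ∎
        where open ≡-Reasoning

      q≤r-cases : ∀ μ ν → ¬ (μ ≡ μ₀ × ν ≡ ν₀) → Dec (μ ≡ μ₀) → Dec (μ ≡ L) → Dec (ν ≡ ν₀) → q ≤ r μ ν
      q≤r-cases μ ν off-corner (yes refl) _          (yes refl) = ⊥-elim (off-corner (refl , refl))
      q≤r-cases μ ν off-corner (yes refl) _          (no ν≢ν₀)  = subst (q ≤_) (sym (r-row ν≢ν₀)) (q≤N*q (n ℕ.* S μ₀) (s≤s z≤n))
      q≤r-cases μ ν off-corner (no _)     (yes refl) (yes refl) = subst (q ≤_) (sym r-column) (q≤N*q (n' ℕ.* S L ℕ.+ n' ℕ.* S μ₀) (s≤s z≤n))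
      q≤r-cases μ ν off-corner (no _)     (yes refl) (no ν≢ν₀)  =
        subst (q ≤_) (sym (r-heavyRow ν≢ν₀)) (q≤N*q (n' ℕ.* S L ℕ.∸ S μ₀) (ℕₚ.m<n⇒0<n∸m S₀<n'S[L]))
      q≤r-cases μ ν off-corner (no μ≢μ₀)  (no μ≢L)   _          = subst (q ≤_) (sym (r-elsewhere μ≢μ₀ μ≢L)) (q≤y μ ν)

      q≤r : ∀ μ ν → ¬ (μ ≡ μ₀ × ν ≡ ν₀) → q ≤ r μ ν
      q≤r μ ν off-corner = q≤r-cases μ ν off-corner (μ Finₚ.≟ μ₀) (μ Finₚ.≟ L) (ν Finₚ.≟ ν₀)

      0≤r-cases : ∀ μ ν → Dec (μ ≡ μ₀ × ν ≡ ν₀) → 0ℚ ≤ r μ ν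
      0≤r-cases μ ν (yes (refl , refl)) = ℚₚ.≤-reflexive (sym r-corner)
      0≤r-cases μ ν (no off-corner)     = ℚₚ.≤-trans (ℚₚ.<⇒≤ 0<q) (q≤r μ ν off-corner)

      0≤r : ∀ μ ν → 0ℚ ≤ r μ ν
      0≤r μ ν = 0≤r-cases μ ν ((μ Finₚ.≟ μ₀) ×-dec (ν Finₚ.≟ ν₀))

      r∈P : P r
      r∈P = transport-shift s t y∈P
        (zeroMargins-scale α {λ μ ν → rowShift μ * colShift ν} (zeroMargins-outer rowShift colShift (Σℚ-δ-δ μ₀ L) Σ-colShift))
        0≤r

      r≢0 : ∀ μ ν → ¬ (μ ≡ μ₀ × ν ≡ ν₀) → r μ ν ≢ 0ℚ
      r≢0 μ ν off-corner r≡0 = ℚₚ.<⇒≢ (ℚₚ.<-≤-trans 0<q (q≤r μ ν off-corner)) (sym r≡0)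

  Pd-numFacets : NumFacets P (m ℕ.* n)
  Pd-numFacets = numFacets-coordinate P
    (λ μ ν → coordinateFace-isFacet s t 0<q y∈P q≤y (Corner.r∈P μ ν) μ ν (Corner.r-corner μ ν) (Corner.q≤r μ ν))
    (λ μ ν → Corner.r μ ν , (Corner.r∈P μ ν , dot-negUnit≡0 μ ν (Corner.r μ ν) (Corner.r-corner μ ν)) , Corner.r≢0 μ ν)
    (λ c b → facet⇒coordinateFace s t {B = ℕ→ℚ m} (0<ℕ→ℚ[1+n] (suc m'')) (λ _ → ℚₚ.≤-refl) y∈P 0<y {c} {b})

lemma4p3 : (m n : ℕ) (d : Fin m → ℕ) → n ≡ suc (Σℕ d) →
    Σ (Fin m) (λ μ₁ → Σ (Fin m) (λ μ₂ → ¬ μ₁ ≡ μ₂ × 1 ℕ.≤ d μ₁ × 1 ℕ.≤ d μ₂)) →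
    NumFacets (Pd {m} {n} d) (m ℕ.* n)
lemma4p3 zero             n d _ (() , _)
lemma4p3 (suc zero)       n d _ (zero , zero , μ₁≢μ₂ , _) = ⊥-elim (μ₁≢μ₂ refl)
lemma4p3 (suc (suc m'')) .(suc (Σℕ d)) d refl (μ₁ , μ₂ , μ₁≢μ₂ , 1≤d₁ , 1≤d₂)
  with Σℕ d in Σd≡ | term≤Σℕ d μ₁
... | zero    | d₁≤0 = ⊥-elim (ℕₚ.<-irrefl refl (ℕₚ.<-≤-trans 1≤d₁ d₁≤0))
... | suc n'' | _    = Pd-numFacets d Σd≡ μ₁≢μ₂ 1≤d₁ 1≤d₂
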